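{- Let $K$ be an imaginary quadratic field, $\mathcal{O}$ an order in $K$, $N$ a positive integer, $Q=ax^2+bxy+cy^2\in\mathcal{Q}(D_\mathcal{O},N)$, $\mathfrak{c}=\mathbb{Z}\omega_Q+\mathbb{Z}$, and $[\mathfrak{c}]$ its class in $\mathcal{C}_N(\mathcal{O})$. Let $P=\{\lambda\in a\overline{\mathfrak{c}}:\lambda\neq0,\ \lambda\equiv1\pmod{N\mathcal{O}}\}$, where $\overline{\mathfrak{c}}$ is the complex conjugate of $\mathfrak{c}$. Then: (i) $[\mathfrak{c}]\cap\mathcal{M}(\mathcal{O},N)=\{\lambda\mathfrak{c}:\lambda\in P\}$; (ii) for $\lambda,\mu\in P$, $\lambda\mathfrak{c}=\mu\mathfrak{c}$ if and only if $\mu=\zeta\lambda$ for some $\zeta\in\mathcal{O}^*$ with $\zeta\equiv1\pmod{N\mathcal{O}}$.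
   Context: $D_\mathcal{O}$ is the discriminant of $\mathcal{O}$. $\mathcal{Q}(D_\mathcal{O},N)$: forms $ax^2+bxy+cy^2\in\mathbb{Z}[x,y]$ with $\gcd(a,b,c)=1$, $b^2-4ac=D_\mathcal{O}$, $a>0$, $\gcd(a,N)=1$; $\omega_Q=(-b+\sqrt{D_\mathcal{O}})/(2a)$. A fractional $\mathcal{O}$-ideal $\mathfrak{a}$ is proper if $\{\beta\in K:\beta\mathfrak{a}\subseteq\mathfrak{a}\}=\mathcal{O}$; $\mathcal{M}(\mathcal{O},N)$ is the set of nonzero proper $\mathcal{O}$-ideals $\mathfrak{a}$ with $\mathfrak{a}+N\mathcal{O}=\mathcal{O}$; $I(\mathcal{O},N)$ the group they generate; $P_N(\mathcal{O})$ the subgroup generated by $\nu\mathcal{O}$, $\nu\in\mathcal{O}\setminus\{0\}$, $\nu\equiv1\pmod{N\mathcal{O}}$; $\mathcal{C}_N(\mathcal{O})=I(\mathcal{O},N)/P_N(\mathcal{O})$. Congruence $\lambda\equiv1\pmod{N\mathcal{O}}$ means $\lambda-1\in N\mathcal{O}$. -}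

module Defs where

open import Data.Nat as ℕ using (ℕ; NonZero)
open import Data.Integer as ℤ using (ℤ; +_; -[1+_])
open import Data.Integer.GCD using (gcd)
open import Data.Rational as ℚ using (ℚ; 0ℚ; 1ℚ)
open import Data.Product using (Σ; ∃; ∃-syntax; _×_; _,_)
open import Data.Sum using (_⊎_)
open import Relation.Binary.PropositionalEquality using (_≡_)
open import Relation.Nullary using (¬_)

ι : ℤ → ℚ
ι z = z ℚ./ 1

½ : ℚ
½ = + 1 ℚ./ 2

-- The quadratic field K = ℚ(√D), D < 0.  An element (x , y) stands for x + y √D.
-- We fix the complex embedding √D = i √|D|, so complex conjugation is (x , y) ↦ (x , -y).
K : Set
K = ℚ × ℚ

-- 1/(2a) for a ≠ 0 (junk value 0 for a = 0, never used since a > 0)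
inv2 : ℤ → ℚ
inv2 (+ 0) = 0ℚ
inv2 (+ ℕ.suc n) = + 1 ℚ./ (2 ℕ.* ℕ.suc n)
inv2 -[1+ n ] = -[1+ 0 ] ℚ./ (2 ℕ.* ℕ.suc n)

module _ (D : ℤ) where

  0K 1K : K
  0K = (0ℚ , 0ℚ)
  1K = (1ℚ , 0ℚ)

  _+K_ _-K_ _*K_ : K → K → K
  (x₁ , y₁) +K (x₂ , y₂) = (x₁ ℚ.+ x₂ , y₁ ℚ.+ y₂)
  (x₁ , y₁) -K (x₂ , y₂) = (x₁ ℚ.- x₂ , y₁ ℚ.- y₂)
  (x₁ , y₁) *K (x₂ , y₂) = (x₁ ℚ.* x₂ ℚ.+ ι D ℚ.* (y₁ ℚ.* y₂) , x₁ ℚ.* y₂ ℚ.+ y₁ ℚ.* x₂)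

  conj : K → K
  conj (x , y) = (x , ℚ.- y)

  ιK : ℤ → K
  ιK z = (ι z , 0ℚ)

  -- The order 𝒪 of discriminant D:  𝒪 = ℤ + ℤ (D + √D)/2
  InO : K → Set
  InO α = ∃[ m ] ∃[ n ] (α ≡ (ι m ℚ.+ ι n ℚ.* ι D ℚ.* ½ , ι n ℚ.* ½))

  IsUnit : K → Set
  IsUnit ζ = InO ζ × ∃[ η ] (InO η × (ζ *K η) ≡ 1K)

  Cong1 : ℕ → K → Set
  Cong1 N λ' = ∃[ γ ] (InO γ × (λ' -K 1K) ≡ (ιK (+ N) *K γ))

  SubK : Set₁
  SubK = K → Set

  _≐_ : SubK → SubK → Set
  A ≐ B = ∀ x → (A x → B x) × (B x → A x)

  scale : K → SubK → SubK
  scale λ' A x = ∃[ α ] (A α × x ≡ (λ' *K α))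

  IsOIdeal : SubK → Set
  IsOIdeal A = (∀ x → A x → InO x)
             × A 0K
             × (∀ x y → A x → A y → A (x +K y))
             × (∀ r x → InO r → A x → A (r *K x))

  NonzeroSub : SubK → Set
  NonzeroSub A = ∃[ x ] (A x × ¬ (x ≡ 0K))

  IsProper : SubK → Set
  IsProper A = ∀ β → ((∀ α → A α → A (β *K α)) → InO β) × (InO β → ∀ α → A α → A (β *K α))

  -- 𝔞 + N𝒪 = 𝒪  (the inclusion ⊆ is automatic for an integral ideal)
  CoprimeTo : ℕ → SubK → Set
  CoprimeTo N A = ∀ x → InO x → ∃[ α ] ∃[ γ ] (A α × InO γ × x ≡ (α +K (ιK (+ N) *K γ)))

  InM : ℕ → SubK → Set
  InM N A = IsOIdeal A × NonzeroSub A × IsProper A × CoprimeTo N A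

  PGen : ℕ → K → Set
  PGen N ν = InO ν × ¬ (ν ≡ 0K) × Cong1 N ν

  -- [𝔞] = [𝔟] in 𝒞_N(𝒪) = I(𝒪,N)/P_N(𝒪).  Every element of P_N(𝒪) is of the form
  -- (ν/μ)𝒪 with ν, μ generators, so 𝔞𝔟⁻¹ ∈ P_N(𝒪) iff ν𝔞 = μ𝔟 for such ν, μ.
  SameClass : ℕ → SubK → SubK → Set
  SameClass N A B = ∃[ ν ] ∃[ μ ] (PGen N ν × PGen N μ × scale ν A ≐ scale μ B)

  InQ : ℕ → ℤ → ℤ → ℤ → Set
  InQ N a b c = gcd (gcd a b) c ≡ + 1
              × (b ℤ.* b ℤ.- (+ 4) ℤ.* a ℤ.* c) ≡ D
              × (+ 0) ℤ.< a
              × gcd a (+ N) ≡ + 1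

  ωQ : ℤ → ℤ → K
  ωQ a b = (ℚ.- ι b ℚ.* inv2 a , inv2 a)

  Lat : ℤ → ℤ → SubK
  Lat a b x = ∃[ m ] ∃[ n ] (x ≡ ((ιK m *K ωQ a b) +K ιK n))

  PSet : ℕ → ℤ → ℤ → K → Set
  PSet N a b λ' = (∃[ x ] (Lat a b x × λ' ≡ (ιK a *K conj x))) × ¬ (λ' ≡ 0K) × Cong1 N λ'

IsDiscr : ℤ → Set
IsDiscr D = ∃[ k ] ((D ≡ (+ 4) ℤ.* k) ⊎ (D ≡ (+ 4) ℤ.* k ℤ.+ (+ 1)))

-- With θ = aω = (-b + √D)/2, a root of X² + bX + ac, one has 𝒪 = ℤθ + ℤ and 𝔠 = ℤω + ℤ, and
-- conj θ = -b - θ gives a·conj(mω + n) = -mθ + (an - mb).  Hence 𝒪𝔠 ⊆ 𝔠; conversely, if β = mω + n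
-- satisfies β𝔠 ⊆ 𝔠 then a divides mb and mc, so a ∣ m because gcd(a, b, c) = 1, and β ∈ 𝒪.  The same
-- computation identifies a𝔠̄ with (𝒪 : 𝔠) = {λ : λ𝔠 ⊆ 𝒪}.
-- The rest is formal for a proper 𝒪-module L ∋ 1 inside the domain K (the norm is positive definite
-- as D < 0): if ν𝔞 = μL with ν, μ ≡ 1 then μ = να₀ with α₀ ∈ 𝔞, so 𝔞 = α₀L, and α₀ ≡ 1 because
-- α₀ - 1 = (μ - 1) - α₀(ν - 1); if λL = μL then μ/λ and λ/μ stabilise L, so they are mutually
-- inverse elements of 𝒪.

module Submission where

open import Defs
open import Data.Nat as ℕ using (ℕ)
open import Data.Integer as ℤ using (ℤ; +_; -[1+_])
open import Data.Product using (∃-syntax; _×_; _,_; proj₁; proj₂)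
open import Data.Sum using (inj₁; inj₂)
open import Data.Maybe using (Maybe; just; nothing)
open import Relation.Binary.PropositionalEquality
  using (_≡_; refl; sym; trans; cong; cong₂; subst; isEquivalence; ≢-sym; module ≡-Reasoning)
open import Relation.Nullary using (¬_; yes; no)
open import Algebra.Bundles using (CommutativeRing)
open import Algebra.Structures using (IsCommutativeRing)
import Algebra.Solver.Ring
import Algebra.Properties.CommutativeSemigroup as CommutativeSemigroupProperties
import Algebra.Solver.Ring.AlmostCommutativeRing as ACR
open import Data.Rational as ℚ using (ℚ; 0ℚ; 1ℚ; ↥_)
open import Data.Rational.Literals using (fromℤ)
import Data.Rational.Properties as ℚP
open import Data.Rational.Solver using (module +-*-Solver)
open import Data.Integer.Solver renaming (module +-*-Solver to ℤ-Solver)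
import Data.Integer.Properties as ℤP
import Data.Nat.Coprimality as ℕC
import Data.Nat.Divisibility as ℕD
import Data.Nat.GCD as ℕG
import Data.Nat.Properties as ℕP
open import Data.Integer.GCD using (gcd)
import Data.Integer.Divisibility.Signed as ℤDS
import Data.Integer.DivMod as ℤDM

-- Integers and rationals

ι≡fromℤ : ∀ z → ι z ≡ fromℤ z
ι≡fromℤ (+ n)    = ℚP.normalize-coprime (ℕC.sym (ℕC.1-coprimeTo n))
ι≡fromℤ -[1+ n ] = cong ℚ.-_ (ℚP.normalize-coprime (ℕC.sym (ℕC.1-coprimeTo (ℕ.suc n))))

ι-+ : ∀ x y → ι (x ℤ.+ y) ≡ ι x ℚ.+ ι y
ι-+ x y rewrite ι≡fromℤ x | ι≡fromℤ y =
  cong (λ t → t ℚ./ 1) (sym (cong₂ ℤ._+_ (ℤP.*-identityʳ x) (ℤP.*-identityʳ y)))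

ι-* : ∀ x y → ι (x ℤ.* y) ≡ ι x ℚ.* ι y
ι-* x y rewrite ι≡fromℤ x | ι≡fromℤ y | ι≡fromℤ (x ℤ.* y) = refl

ι-neg : ∀ x → ι (ℤ.- x) ≡ ℚ.- ι x
ι-neg x rewrite ι≡fromℤ x | ι≡fromℤ (ℤ.- x) = fromℤ-neg x
  where
  fromℤ-neg : ∀ x → fromℤ (ℤ.- x) ≡ ℚ.- fromℤ x
  fromℤ-neg (+ ℕ.zero)  = refl
  fromℤ-neg (+ ℕ.suc n) = refl
  fromℤ-neg -[1+ n ]    = refl

ι-injective : ∀ {x y} → ι x ≡ ι y → x ≡ y
ι-injective {x} {y} e rewrite ι≡fromℤ x | ι≡fromℤ y = cong ↥_ e

ℚ-zero-product : ∀ x y → x ℚ.* y ≡ 0ℚ → ¬ x ≡ 0ℚ → y ≡ 0ℚ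
ℚ-zero-product x y xy≡0 x≢0 = begin
  y                ≡⟨ sym (ℚP.*-identityˡ y) ⟩
  1ℚ ℚ.* y         ≡⟨ cong (ℚ._* y) (sym (ℚP.*-inverseˡ x)) ⟩
  (x⁻¹ ℚ.* x) ℚ.* y ≡⟨ ℚP.*-assoc x⁻¹ x y ⟩
  x⁻¹ ℚ.* (x ℚ.* y) ≡⟨ cong (x⁻¹ ℚ.*_) xy≡0 ⟩
  x⁻¹ ℚ.* 0ℚ       ≡⟨ ℚP.*-zeroʳ x⁻¹ ⟩
  0ℚ               ∎
  where
  open ≡-Reasoning
  instance _ = ℚ.≢-nonZero x≢0
  x⁻¹ = ℚ.1/ x

square-nonneg : ∀ p → 0ℚ ℚ.≤ p ℚ.* p
square-nonneg p with ℚP.≤-total 0ℚ p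
... | inj₁ 0≤p = ℚP.nonNegative⁻¹ _ {{ℚP.nonNeg*nonNeg⇒nonNeg p {{ℚ.nonNegative 0≤p}} p {{ℚ.nonNegative 0≤p}}}}
... | inj₂ p≤0 = ℚP.nonNegative⁻¹ _ {{ℚP.nonPos*nonPos⇒nonPos p {{ℚ.nonPositive p≤0}} p {{ℚ.nonPositive p≤0}}}}

nonneg-sum-zeroˡ : ∀ {x y} → 0ℚ ℚ.≤ x → 0ℚ ℚ.≤ y → x ℚ.+ y ≡ 0ℚ → x ≡ 0ℚ
nonneg-sum-zeroˡ {x} {y} 0≤x 0≤y x+y≡0 = ℚP.≤-antisym x≤0 0≤x
  where
  open ℚP.≤-Reasoning
  x≤0 : x ℚ.≤ 0ℚ
  x≤0 = begin
    x          ≡⟨ ℚP.+-identityʳ x ⟨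
    x ℚ.+ 0ℚ   ≤⟨ ℚP.+-monoʳ-≤ x 0≤y ⟩
    x ℚ.+ y    ≡⟨ x+y≡0 ⟩
    0ℚ         ∎

positive-definite : ∀ {e} p q → 0ℚ ℚ.< e → p ℚ.* p ℚ.+ e ℚ.* (q ℚ.* q) ≡ 0ℚ → p ≡ 0ℚ × q ≡ 0ℚ
positive-definite {e} p q 0<e n≡0 = square-zero p p²≡0 , square-zero q q²≡0
  where
  square-zero : ∀ r → r ℚ.* r ≡ 0ℚ → r ≡ 0ℚ
  square-zero r r²≡0 with r ℚP.≟ 0ℚ
  ... | yes r≡0 = r≡0
  ... | no r≢0  = ℚ-zero-product r r r²≡0 r≢0
  0≤eq² : 0ℚ ℚ.≤ e ℚ.* (q ℚ.* q)
  0≤eq² = ℚP.nonNegative⁻¹ _ {{ℚP.nonNeg*nonNeg⇒nonNeg e {{ℚ.nonNegative (ℚP.<⇒≤ 0<e)}} (q ℚ.* q) {{ℚ.nonNegative (square-nonneg q)}}}}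
  p²≡0 : p ℚ.* p ≡ 0ℚ
  p²≡0 = nonneg-sum-zeroˡ (square-nonneg p) 0≤eq² n≡0
  q²≡0 : q ℚ.* q ≡ 0ℚ
  q²≡0 = ℚ-zero-product e (q ℚ.* q)
           (nonneg-sum-zeroˡ 0≤eq² (square-nonneg p) (trans (ℚP.+-comm (e ℚ.* (q ℚ.* q)) (p ℚ.* p)) n≡0))
           (≢-sym (ℚP.<⇒≢ 0<e))

neg-ι-positive : ∀ {z} → z ℤ.< + 0 → 0ℚ ℚ.< ℚ.- ι z
neg-ι-positive { -[1+ m ]} _ rewrite ι≡fromℤ -[1+ m ] = ℚP.positive⁻¹ (fromℤ (+ ℕ.suc m))
neg-ι-positive { + n} (ℤ.+<+ ())

ι-*-recip : ∀ k → ι (+ ℕ.suc k) ℚ.* (+ 1 ℚ./ ℕ.suc k) ≡ 1ℚ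
ι-*-recip k = trans (cong₂ ℚ._*_ (ι≡fromℤ (+ ℕ.suc k)) (ℚP.normalize-coprime (ℕC.1-coprimeTo (ℕ.suc k))))
                    (ℚP.*-inverseʳ (fromℤ (+ ℕ.suc k)))

½≢0 : ¬ ½ ≡ 0ℚ
½≢0 ()

ι-*-inv2 : ∀ a₀ → ι (+ ℕ.suc a₀) ℚ.* inv2 (+ ℕ.suc a₀) ≡ ½
ι-*-inv2 a₀ = begin
  ι a ℚ.* inv2 a                     ≡⟨ solve 2 (λ x i → x :* i := con ½ :* ((con (ι (+ 2)) :* x) :* i)) refl (ι a) (inv2 a) ⟩
  ½ ℚ.* ((ι (+ 2) ℚ.* ι a) ℚ.* inv2 a) ≡⟨ cong (λ t → ½ ℚ.* (t ℚ.* inv2 a)) (ι-* (+ 2) a) ⟨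
  ½ ℚ.* (ι (+ 2 ℤ.* a) ℚ.* inv2 a)    ≡⟨ cong (½ ℚ.*_) (ι-*-recip (a₀ ℕ.+ ℕ.suc (a₀ ℕ.+ 0))) ⟩
  ½ ℚ.* 1ℚ                           ≡⟨ ℚP.*-identityʳ ½ ⟩
  ½                                  ∎
  where
  open ≡-Reasoning
  open +-*-Solver
  a = + ℕ.suc a₀
  -- ι-*-recip is applied with 2 ℕ.* suc a₀ written as suc (a₀ ℕ.+ suc (a₀ ℕ.+ 0)), its normal form.

IsDiscr⇒4∣D²-D : ∀ {D} → IsDiscr D → ∃[ k ] (+ 4 ℤ.* k ≡ D ℤ.* D ℤ.- D)
IsDiscr⇒4∣D²-D (k , inj₁ refl) = k ℤ.* (+ 4 ℤ.* k ℤ.- + 1) ,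
  solve 1 (λ k → con (+ 4) :* (k :* (con (+ 4) :* k :- con (+ 1)))
               := con (+ 4) :* k :* (con (+ 4) :* k) :- con (+ 4) :* k) refl k
  where
  open ℤ-Solver
IsDiscr⇒4∣D²-D (k , inj₂ refl) = k ℤ.* (+ 4 ℤ.* k ℤ.+ + 1) ,
  solve 1 (λ k → con (+ 4) :* (k :* (con (+ 4) :* k :+ con (+ 1)))
               := (con (+ 4) :* k :+ con (+ 1)) :* (con (+ 4) :* k :+ con (+ 1)) :- (con (+ 4) :* k :+ con (+ 1))) refl k
  where
  open ℤ-Solver

discriminant-parity : ∀ b a c → ∃[ h ] (b ℤ.+ (b ℤ.* b ℤ.- + 4 ℤ.* a ℤ.* c) ≡ + 2 ℤ.* h)
discriminant-parity b a c = go b {q = b ℤDM./ℕ 2} (ℤDM.n%ℕd<d b 2) (ℤDM.a≡a%ℕn+[a/ℕn]*n b 2)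
  where
  open ℤ-Solver
  go : ∀ b {r q} → r ℕ.< 2 → b ≡ + r ℤ.+ q ℤ.* + 2 → ∃[ h ] (b ℤ.+ (b ℤ.* b ℤ.- + 4 ℤ.* a ℤ.* c) ≡ + 2 ℤ.* h)
  go _ {0} {q} _ refl = q ℤ.+ + 2 ℤ.* q ℤ.* q ℤ.- + 2 ℤ.* a ℤ.* c ,
    solve 3 (λ q a c → let b = con (+ 0) :+ q :* con (+ 2) in b :+ (b :* b :- con (+ 4) :* a :* c)
                     := con (+ 2) :* (q :+ con (+ 2) :* q :* q :- con (+ 2) :* a :* c)) refl q a c
  go _ {1} {q} _ refl = (+ 2 ℤ.* q ℤ.+ + 1) ℤ.* (q ℤ.+ + 1) ℤ.- + 2 ℤ.* a ℤ.* c ,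
    solve 3 (λ q a c → let b = con (+ 1) :+ q :* con (+ 2) in b :+ (b :* b :- con (+ 4) :* a :* c)
                     := con (+ 2) :* ((con (+ 2) :* q :+ con (+ 1)) :* (q :+ con (+ 1)) :- con (+ 2) :* a :* c)) refl q a c
  go _ {ℕ.suc (ℕ.suc _)} (ℕ.s≤s (ℕ.s≤s ())) _

∣-*-gcd : ∀ m {d b c} → d ℕD.∣ m ℕ.* b → d ℕD.∣ m ℕ.* c → d ℕD.∣ m ℕ.* ℕG.gcd b c
∣-*-gcd m {d} {b} {c} d∣mb d∣mc =
  subst (d ℕD.∣_) (sym (ℕG.c*gcd[m,n]≡gcd[cm,cn] m b c)) (ℕG.gcd-greatest d∣mb d∣mc)

primitive-divisor : ∀ {a b c m} → gcd (gcd a b) c ≡ + 1 → a ℤDS.∣ m ℤ.* b → a ℤDS.∣ m ℤ.* c → a ℤDS.∣ m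
primitive-divisor {a} {b} {c} {m} gcd≡1 a∣mb a∣mc = ℤDS.∣ᵤ⇒∣ (subst (ℤ.∣ a ∣ ℕD.∣_) (ℕP.*-identityʳ ℤ.∣ m ∣) a∣m*gcd)
  where
  unsigned : ∀ {x} → a ℤDS.∣ m ℤ.* x → ℤ.∣ a ∣ ℕD.∣ ℤ.∣ m ∣ ℕ.* ℤ.∣ x ∣
  unsigned {x} a∣mx = subst (ℤ.∣ a ∣ ℕD.∣_) (ℤP.abs-* m x) (ℤDS.∣⇒∣ᵤ a∣mx)
  a∣m*gcd : ℤ.∣ a ∣ ℕD.∣ ℤ.∣ m ∣ ℕ.* 1
  a∣m*gcd = subst (λ g → ℤ.∣ a ∣ ℕD.∣ ℤ.∣ m ∣ ℕ.* g) (ℤP.+-injective gcd≡1)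
              (∣-*-gcd ℤ.∣ m ∣ (∣-*-gcd ℤ.∣ m ∣ (ℕD.n∣m*n ℤ.∣ m ∣) (unsigned a∣mb)) (unsigned a∣mc))

∣-via-difference : ∀ {a y} n k → a ℤ.* n ℤ.- y ≡ a ℤ.* k → a ℤDS.∣ y
∣-via-difference {a} {y} n k an-y≡ak = ℤDS.divides (n ℤ.- k) (begin
  y                             ≡⟨ solve 3 (λ y n a → y := a :* n :- (a :* n :- y)) refl y n a ⟩
  a ℤ.* n ℤ.- (a ℤ.* n ℤ.- y)   ≡⟨ cong (λ t → a ℤ.* n ℤ.- t) an-y≡ak ⟩
  a ℤ.* n ℤ.- a ℤ.* k           ≡⟨ solve 3 (λ n a k → a :* n :- a :* k := (n :- k) :* a) refl n a k ⟩
  (n ℤ.- k) ℤ.* a               ∎)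
  where
  open ≡-Reasoning
  open ℤ-Solver

-- The field K = ℚ(√D) and its order 𝒪

module QuadraticField (D : ℤ) where

  infixl 6 _⊕_ _⊖_
  infixl 7 _⊗_
  infix  8 ⊝_

  _⊕_ _⊖_ _⊗_ : K → K → K
  _⊕_ = _+K_ D
  _⊖_ = _-K_ D
  _⊗_ = _*K_ D

  ⊝_ : K → K
  ⊝ (x , y) = (ℚ.- x , ℚ.- y)

  𝟘 𝟙 : K
  𝟘 = 0K D
  𝟙 = 1K D

  [_] : ℤ → K
  [_] = ιK D

  module _ where
    open +-*-Solver

    ⊕-assoc : ∀ p q r → (p ⊕ q) ⊕ r ≡ p ⊕ (q ⊕ r)
    ⊕-assoc (x₁ , y₁) (x₂ , y₂) (x₃ , y₃) = cong₂ _,_ (ℚP.+-assoc x₁ x₂ x₃) (ℚP.+-assoc y₁ y₂ y₃)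

    ⊕-comm : ∀ p q → p ⊕ q ≡ q ⊕ p
    ⊕-comm (x₁ , y₁) (x₂ , y₂) = cong₂ _,_ (ℚP.+-comm x₁ x₂) (ℚP.+-comm y₁ y₂)

    ⊕-identityˡ : ∀ p → 𝟘 ⊕ p ≡ p
    ⊕-identityˡ (x , y) = cong₂ _,_ (ℚP.+-identityˡ x) (ℚP.+-identityˡ y)

    ⊕-identityʳ : ∀ p → p ⊕ 𝟘 ≡ p
    ⊕-identityʳ (x , y) = cong₂ _,_ (ℚP.+-identityʳ x) (ℚP.+-identityʳ y)

    ⊕-inverseˡ : ∀ p → ⊝ p ⊕ p ≡ 𝟘
    ⊕-inverseˡ (x , y) = cong₂ _,_ (ℚP.+-inverseˡ x) (ℚP.+-inverseˡ y)

    ⊕-inverseʳ : ∀ p → p ⊕ ⊝ p ≡ 𝟘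
    ⊕-inverseʳ (x , y) = cong₂ _,_ (ℚP.+-inverseʳ x) (ℚP.+-inverseʳ y)

    ⊗-assoc : ∀ p q r → (p ⊗ q) ⊗ r ≡ p ⊗ (q ⊗ r)
    ⊗-assoc (x₁ , y₁) (x₂ , y₂) (x₃ , y₃) = cong₂ _,_
      (solve 7 (λ x₁ y₁ x₂ y₂ x₃ y₃ d →
          (x₁ :* x₂ :+ d :* (y₁ :* y₂)) :* x₃ :+ d :* ((x₁ :* y₂ :+ y₁ :* x₂) :* y₃)
        := x₁ :* (x₂ :* x₃ :+ d :* (y₂ :* y₃)) :+ d :* (y₁ :* (x₂ :* y₃ :+ y₂ :* x₃)))
        refl x₁ y₁ x₂ y₂ x₃ y₃ (ι D))
      (solve 7 (λ x₁ y₁ x₂ y₂ x₃ y₃ d →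
          (x₁ :* x₂ :+ d :* (y₁ :* y₂)) :* y₃ :+ (x₁ :* y₂ :+ y₁ :* x₂) :* x₃
        := x₁ :* (x₂ :* y₃ :+ y₂ :* x₃) :+ y₁ :* (x₂ :* x₃ :+ d :* (y₂ :* y₃)))
        refl x₁ y₁ x₂ y₂ x₃ y₃ (ι D))

    ⊗-comm : ∀ p q → p ⊗ q ≡ q ⊗ p
    ⊗-comm (x₁ , y₁) (x₂ , y₂) = cong₂ _,_
      (solve 5 (λ x₁ y₁ x₂ y₂ d → x₁ :* x₂ :+ d :* (y₁ :* y₂) := x₂ :* x₁ :+ d :* (y₂ :* y₁))
        refl x₁ y₁ x₂ y₂ (ι D))
      (solve 4 (λ x₁ y₁ x₂ y₂ → x₁ :* y₂ :+ y₁ :* x₂ := x₂ :* y₁ :+ y₂ :* x₁) refl x₁ y₁ x₂ y₂)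

    ⊗-identityˡ : ∀ p → 𝟙 ⊗ p ≡ p
    ⊗-identityˡ (x , y) = cong₂ _,_
      (solve 3 (λ x y d → con 1ℚ :* x :+ d :* (con 0ℚ :* y) := x) refl x y (ι D))
      (solve 2 (λ x y → con 1ℚ :* y :+ con 0ℚ :* x := y) refl x y)

    ⊗-distribˡ-⊕ : ∀ p q r → p ⊗ (q ⊕ r) ≡ p ⊗ q ⊕ p ⊗ r
    ⊗-distribˡ-⊕ (x₁ , y₁) (x₂ , y₂) (x₃ , y₃) = cong₂ _,_
      (solve 7 (λ x₁ y₁ x₂ y₂ x₃ y₃ d →
          x₁ :* (x₂ :+ x₃) :+ d :* (y₁ :* (y₂ :+ y₃))
        := (x₁ :* x₂ :+ d :* (y₁ :* y₂)) :+ (x₁ :* x₃ :+ d :* (y₁ :* y₃)))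
        refl x₁ y₁ x₂ y₂ x₃ y₃ (ι D))
      (solve 6 (λ x₁ y₁ x₂ y₂ x₃ y₃ →
          x₁ :* (y₂ :+ y₃) :+ y₁ :* (x₂ :+ x₃) := (x₁ :* y₂ :+ y₁ :* x₂) :+ (x₁ :* y₃ :+ y₁ :* x₃))
        refl x₁ y₁ x₂ y₂ x₃ y₃)

    conj-⊕ : ∀ p q → conj D (p ⊕ q) ≡ conj D p ⊕ conj D q
    conj-⊕ (x₁ , y₁) (x₂ , y₂) = cong (x₁ ℚ.+ x₂ ,_) (ℚP.neg-distrib-+ y₁ y₂)

    conj-⊗ : ∀ p q → conj D (p ⊗ q) ≡ conj D p ⊗ conj D q
    conj-⊗ (x₁ , y₁) (x₂ , y₂) = cong₂ _,_
      (solve 5 (λ x₁ y₁ x₂ y₂ d → x₁ :* x₂ :+ d :* (y₁ :* y₂) := x₁ :* x₂ :+ d :* ((:- y₁) :* (:- y₂)))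
        refl x₁ y₁ x₂ y₂ (ι D))
      (solve 4 (λ x₁ y₁ x₂ y₂ → :- (x₁ :* y₂ :+ y₁ :* x₂) := x₁ :* (:- y₂) :+ (:- y₁) :* x₂)
        refl x₁ y₁ x₂ y₂)

  ⊗-identityʳ : ∀ p → p ⊗ 𝟙 ≡ p
  ⊗-identityʳ p = trans (⊗-comm p 𝟙) (⊗-identityˡ p)

  K-isCommutativeRing : IsCommutativeRing _≡_ _⊕_ _⊗_ ⊝_ 𝟘 𝟙
  K-isCommutativeRing = record
    { isRing = record
      { +-isAbelianGroup = record
        { isGroup = record
          { isMonoid = record
            { isSemigroup = record
              { isMagma = record { isEquivalence = isEquivalence ; ∙-cong = cong₂ _⊕_ }
              ; assoc = ⊕-assoc }
            ; identity = ⊕-identityˡ , ⊕-identityʳ }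
          ; inverse = ⊕-inverseˡ , ⊕-inverseʳ
          ; ⁻¹-cong = cong ⊝_ }
        ; comm = ⊕-comm }
      ; *-cong = cong₂ _⊗_
      ; *-assoc = ⊗-assoc
      ; *-identity = ⊗-identityˡ , ⊗-identityʳ
      ; distrib = ⊗-distribˡ-⊕ , λ p q r → trans (⊗-comm (q ⊕ r) p)
                                          (trans (⊗-distribˡ-⊕ p q r) (cong₂ _⊕_ (⊗-comm p q) (⊗-comm p r))) }
    ; *-comm = ⊗-comm }

  K-commutativeRing : CommutativeRing _ _
  K-commutativeRing = record { isCommutativeRing = K-isCommutativeRing }

  open CommutativeSemigroupProperties (CommutativeRing.*-commutativeSemigroup K-commutativeRing) public
    using () renaming (x∙yz≈y∙xz to x⊗yz≡y⊗xz)

  ιK-+ : ∀ x y → [ x ℤ.+ y ] ≡ [ x ] ⊕ [ y ]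
  ιK-+ x y = cong (_, 0ℚ) (ι-+ x y)

  ιK-* : ∀ x y → [ x ℤ.* y ] ≡ [ x ] ⊗ [ y ]
  ιK-* x y = cong₂ _,_
    (trans (ι-* x y) (solve 3 (λ x y d → x :* y := x :* y :+ d :* (con 0ℚ :* con 0ℚ)) refl (ι x) (ι y) (ι D)))
    (solve 2 (λ x y → con 0ℚ := x :* con 0ℚ :+ con 0ℚ :* y) refl (ι x) (ι y))
    where
    open +-*-Solver

  ιK-neg : ∀ x → [ ℤ.- x ] ≡ ⊝ [ x ]
  ιK-neg x = cong (_, 0ℚ) (ι-neg x)

  ιK-⊖ : ∀ x y → [ x ℤ.- y ] ≡ [ x ] ⊖ [ y ]
  ιK-⊖ x y = trans (ιK-+ x (ℤ.- y)) (cong ([ x ] ⊕_) (ιK-neg y))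

  ιK-injective : ∀ {x y} → [ x ] ≡ [ y ] → x ≡ y
  ιK-injective e = ι-injective (cong proj₁ e)

  ιK-≟ : (x y : ℤ) → Maybe ([ x ] ≡ [ y ])
  ιK-≟ x y with x ℤ.≟ y
  ... | yes x≡y = just (cong [_] x≡y)
  ... | no _    = nothing

  ιK-morphism : ℤ.+-*-rawRing ACR.-Raw-AlmostCommutative⟶ ACR.fromCommutativeRing K-commutativeRing
  ιK-morphism = record
    { ⟦_⟧    = [_]
    ; +-homo = ιK-+
    ; *-homo = ιK-*
    ; -‿homo = ιK-neg
    ; 0-homo = refl
    ; 1-homo = refl
    }

  module K-Solver = Algebra.Solver.Ring ℤ.+-*-rawRing (ACR.fromCommutativeRing K-commutativeRing) ιK-morphism ιK-≟

  ⊖≡𝟘⇒≡ : ∀ {x y} → x ⊖ y ≡ 𝟘 → x ≡ y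
  ⊖≡𝟘⇒≡ {x} {y} x-y≡0 = begin
    x             ≡⟨ solve 2 (λ x y → x := (x :- y) :+ y) refl x y ⟩
    (x ⊖ y) ⊕ y   ≡⟨ cong (_⊕ y) x-y≡0 ⟩
    𝟘 ⊕ y         ≡⟨ ⊕-identityˡ y ⟩
    y             ∎
    where
    open ≡-Reasoning
    open K-Solver

  no-zero-divisors : D ℤ.< + 0 → ∀ ν x → ¬ ν ≡ 𝟘 → ν ⊗ x ≡ 𝟘 → x ≡ 𝟘
  no-zero-divisors D<0 (p , q) (u , v) ν≢0 νx≡0 =
    cong₂ _,_ (ℚ-zero-product norm u norm*u≡0 norm≢0) (ℚ-zero-product norm v norm*v≡0 norm≢0)
    where
    open ≡-Reasoning
    open +-*-Solver
    d = ι D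
    norm = p ℚ.* p ℚ.+ (ℚ.- d) ℚ.* (q ℚ.* q)
    -- norm ν · x = conj ν · (ν x), written out in coordinates
    norm*u≡0 : norm ℚ.* u ≡ 0ℚ
    norm*u≡0 = begin
      norm ℚ.* u
        ≡⟨ solve 5 (λ p q u v d → (p :* p :+ (:- d) :* (q :* q)) :* u
                               := p :* (p :* u :+ d :* (q :* v)) :- d :* q :* (p :* v :+ q :* u)) refl p q u v d ⟩
      p ℚ.* (p ℚ.* u ℚ.+ d ℚ.* (q ℚ.* v)) ℚ.- d ℚ.* q ℚ.* (p ℚ.* v ℚ.+ q ℚ.* u)
        ≡⟨ cong₂ (λ s t → p ℚ.* s ℚ.- d ℚ.* q ℚ.* t) (cong proj₁ νx≡0) (cong proj₂ νx≡0) ⟩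
      p ℚ.* 0ℚ ℚ.- d ℚ.* q ℚ.* 0ℚ
        ≡⟨ solve 3 (λ p q d → p :* con 0ℚ :- d :* q :* con 0ℚ := con 0ℚ) refl p q d ⟩
      0ℚ ∎
    norm*v≡0 : norm ℚ.* v ≡ 0ℚ
    norm*v≡0 = begin
      norm ℚ.* v
        ≡⟨ solve 5 (λ p q u v d → (p :* p :+ (:- d) :* (q :* q)) :* v
                               := p :* (p :* v :+ q :* u) :- q :* (p :* u :+ d :* (q :* v))) refl p q u v d ⟩
      p ℚ.* (p ℚ.* v ℚ.+ q ℚ.* u) ℚ.- q ℚ.* (p ℚ.* u ℚ.+ d ℚ.* (q ℚ.* v))
        ≡⟨ cong₂ (λ s t → p ℚ.* s ℚ.- q ℚ.* t) (cong proj₂ νx≡0) (cong proj₁ νx≡0) ⟩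
      p ℚ.* 0ℚ ℚ.- q ℚ.* 0ℚ
        ≡⟨ solve 2 (λ p q → p :* con 0ℚ :- q :* con 0ℚ := con 0ℚ) refl p q ⟩
      0ℚ ∎
    norm≢0 : ¬ norm ≡ 0ℚ
    norm≢0 norm≡0 with positive-definite p q (neg-ι-positive D<0) norm≡0
    ... | refl , refl = ν≢0 refl

  ⊗-cancelˡ : D ℤ.< + 0 → ∀ {ν x y} → ¬ ν ≡ 𝟘 → ν ⊗ x ≡ ν ⊗ y → x ≡ y
  ⊗-cancelˡ D<0 {ν} {x} {y} ν≢0 νx≡νy = ⊖≡𝟘⇒≡ (no-zero-divisors D<0 ν (x ⊖ y) ν≢0 (begin
    ν ⊗ (x ⊖ y)      ≡⟨ solve 3 (λ ν x y → ν :* (x :- y) := ν :* x :- ν :* y) refl ν x y ⟩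
    ν ⊗ x ⊖ ν ⊗ y    ≡⟨ cong (_⊖ ν ⊗ y) νx≡νy ⟩
    ν ⊗ y ⊖ ν ⊗ y    ≡⟨ solve 1 (λ z → z :- z := con (+ 0)) refl (ν ⊗ y) ⟩
    𝟘                ∎))
    where
    open ≡-Reasoning
    open K-Solver

  -- Integer coordinates are kept as elements of K, with a proof of integrality, so that the ring
  -- solver over K applies to them directly.
  IsInt : K → Set
  IsInt x = ∃[ z ] (x ≡ [ z ])

  IsInt-ιK : ∀ z → IsInt [ z ]
  IsInt-ιK z = z , refl

  IsInt-⊕ : ∀ {x y} → IsInt x → IsInt y → IsInt (x ⊕ y)
  IsInt-⊕ (z , refl) (w , refl) = z ℤ.+ w , sym (ιK-+ z w)

  IsInt-⊗ : ∀ {x y} → IsInt x → IsInt y → IsInt (x ⊗ y)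
  IsInt-⊗ (z , refl) (w , refl) = z ℤ.* w , sym (ιK-* z w)

  IsInt-⊝ : ∀ {x} → IsInt x → IsInt (⊝ x)
  IsInt-⊝ (z , refl) = ℤ.- z , sym (ιK-neg z)

  IsInt-⊖ : ∀ {x y} → IsInt x → IsInt y → IsInt (x ⊖ y)
  IsInt-⊖ p q = IsInt-⊕ p (IsInt-⊝ q)

  Span : K → K → Set
  Span θ x = ∃[ u ] ∃[ v ] (IsInt u × IsInt v × x ≡ u ⊗ θ ⊕ v)

  module _ {θ : K} where
    open K-Solver

    Span-int : ∀ {x} → IsInt x → Span θ x
    Span-int {x} x∈ℤ = 𝟘 , x , IsInt-ιK (+ 0) , x∈ℤ , solve 2 (λ x θ → x := con (+ 0) :* θ :+ x) refl x θ

    Span-⊕ : ∀ {x y} → Span θ x → Span θ y → Span θ (x ⊕ y)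
    Span-⊕ (u , v , u∈ℤ , v∈ℤ , refl) (u' , v' , u'∈ℤ , v'∈ℤ , refl) =
      u ⊕ u' , v ⊕ v' , IsInt-⊕ u∈ℤ u'∈ℤ , IsInt-⊕ v∈ℤ v'∈ℤ ,
      solve 5 (λ u v u' v' θ → (u :* θ :+ v) :+ (u' :* θ :+ v') := (u :+ u') :* θ :+ (v :+ v')) refl u v u' v' θ

    Span-scale : ∀ {z x} → IsInt z → Span θ x → Span θ (z ⊗ x)
    Span-scale {z} z∈ℤ (u , v , u∈ℤ , v∈ℤ , refl) =
      z ⊗ u , z ⊗ v , IsInt-⊗ z∈ℤ u∈ℤ , IsInt-⊗ z∈ℤ v∈ℤ ,
      solve 4 (λ z u v θ → z :* (u :* θ :+ v) := (z :* u) :* θ :+ z :* v) refl z u v θ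

    Span-⊝ : ∀ {x} → Span θ x → Span θ (⊝ x)
    Span-⊝ {x} x∈ = subst (Span θ) (solve 1 (λ x → con (ℤ.- + 1) :* x := :- x) refl x)
                          (Span-scale (IsInt-ιK (ℤ.- + 1)) x∈)

    Span-⊖ : ∀ {x y} → Span θ x → Span θ y → Span θ (x ⊖ y)
    Span-⊖ x∈ y∈ = Span-⊕ x∈ (Span-⊝ y∈)

    Span-⊗ : ∀ {s t x y} → IsInt s → IsInt t → θ ⊗ θ ≡ s ⊗ θ ⊕ t → Span θ x → Span θ y → Span θ (x ⊗ y)
    Span-⊗ {s} {t} s∈ℤ t∈ℤ θ²≡ (u , v , u∈ℤ , v∈ℤ , refl) (u' , v' , u'∈ℤ , v'∈ℤ , refl) =
      u ⊗ u' ⊗ s ⊕ u ⊗ v' ⊕ v ⊗ u' , u ⊗ u' ⊗ t ⊕ v ⊗ v' ,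
      IsInt-⊕ (IsInt-⊕ (IsInt-⊗ (IsInt-⊗ u∈ℤ u'∈ℤ) s∈ℤ) (IsInt-⊗ u∈ℤ v'∈ℤ)) (IsInt-⊗ v∈ℤ u'∈ℤ) ,
      IsInt-⊕ (IsInt-⊗ (IsInt-⊗ u∈ℤ u'∈ℤ) t∈ℤ) (IsInt-⊗ v∈ℤ v'∈ℤ) ,
      (begin
        (u ⊗ θ ⊕ v) ⊗ (u' ⊗ θ ⊕ v')
          ≡⟨ solve 5 (λ u v u' v' θ → (u :* θ :+ v) :* (u' :* θ :+ v')
                                   := u :* u' :* (θ :* θ) :+ (u :* v' :+ v :* u') :* θ :+ v :* v') refl u v u' v' θ ⟩
        u ⊗ u' ⊗ (θ ⊗ θ) ⊕ (u ⊗ v' ⊕ v ⊗ u') ⊗ θ ⊕ v ⊗ v'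
          ≡⟨ cong (λ θ² → u ⊗ u' ⊗ θ² ⊕ (u ⊗ v' ⊕ v ⊗ u') ⊗ θ ⊕ v ⊗ v') θ²≡ ⟩
        u ⊗ u' ⊗ (s ⊗ θ ⊕ t) ⊕ (u ⊗ v' ⊕ v ⊗ u') ⊗ θ ⊕ v ⊗ v'
          ≡⟨ solve 7 (λ u v u' v' θ s t → u :* u' :* (s :* θ :+ t) :+ (u :* v' :+ v :* u') :* θ :+ v :* v'
                                       := (u :* u' :* s :+ u :* v' :+ v :* u') :* θ :+ (u :* u' :* t :+ v :* v'))
                     refl u v u' v' θ s t ⟩
        (u ⊗ u' ⊗ s ⊕ u ⊗ v' ⊕ v ⊗ u') ⊗ θ ⊕ (u ⊗ u' ⊗ t ⊕ v ⊗ v') ∎)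
      where
      open ≡-Reasoning

    Span-shift : ∀ {θ' x} → IsInt (θ ⊖ θ') → Span θ x → Span θ' x
    Span-shift {θ'} θ-θ'∈ℤ (u , v , u∈ℤ , v∈ℤ , refl) =
      u , u ⊗ (θ ⊖ θ') ⊕ v , u∈ℤ , IsInt-⊕ (IsInt-⊗ u∈ℤ θ-θ'∈ℤ) v∈ℤ ,
      solve 4 (λ u v θ θ' → u :* θ :+ v := u :* θ' :+ (u :* (θ :- θ') :+ v)) refl u v θ θ'

  Span-module : ∀ {ω θ x y} → Span ω θ → Span ω (θ ⊗ ω) → Span θ x → Span ω y → Span ω (x ⊗ y)
  Span-module {ω} {θ} θ∈ θω∈ (u , v , u∈ℤ , v∈ℤ , refl) y∈@(M , n , M∈ℤ , n∈ℤ , refl) =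
    subst (Span ω) (solve 6 (λ u v θ M ω n → u :* (M :* (θ :* ω) :+ n :* θ) :+ v :* (M :* ω :+ n)
                                          := (u :* θ :+ v) :* (M :* ω :+ n)) refl u v θ M ω n)
      (Span-⊕ (Span-scale u∈ℤ (Span-⊕ (Span-scale M∈ℤ θω∈) (Span-scale n∈ℤ θ∈))) (Span-scale v∈ℤ y∈))
    where
    open K-Solver

  Span-independent : ∀ {θ} → ¬ proj₂ θ ≡ 0ℚ → ∀ p q → [ p ] ⊗ θ ⊕ [ q ] ≡ 𝟘 → p ≡ + 0 × q ≡ + 0
  Span-independent {θ₁ , θ₂} θ₂≢0 p q pθ+q≡0 = ι-injective ιp≡0 , ι-injective ιq≡0
    where
    open ≡-Reasoning
    open +-*-Solver
    ιp≡0 : ι p ≡ 0ℚ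
    ιp≡0 = ℚ-zero-product θ₂ (ι p) (begin
      θ₂ ℚ.* ι p
        ≡⟨ solve 3 (λ p θ₁ θ₂ → θ₂ :* p := (p :* θ₂ :+ con 0ℚ :* θ₁) :+ con 0ℚ) refl (ι p) θ₁ θ₂ ⟩
      proj₂ ([ p ] ⊗ (θ₁ , θ₂) ⊕ [ q ])
        ≡⟨ cong proj₂ pθ+q≡0 ⟩
      0ℚ ∎) θ₂≢0
    ιq≡0 : ι q ≡ 0ℚ
    ιq≡0 = begin
      ι q
        ≡⟨ solve 4 (λ q θ₁ θ₂ d → q := (con 0ℚ :* θ₁ :+ d :* (con 0ℚ :* θ₂)) :+ q) refl (ι q) θ₁ θ₂ (ι D) ⟩
      (0ℚ ℚ.* θ₁ ℚ.+ ι D ℚ.* (0ℚ ℚ.* θ₂)) ℚ.+ ι q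
        ≡⟨ cong (λ x → (x ℚ.* θ₁ ℚ.+ ι D ℚ.* (0ℚ ℚ.* θ₂)) ℚ.+ ι q) (sym ιp≡0) ⟩
      proj₁ ([ p ] ⊗ (θ₁ , θ₂) ⊕ [ q ])
        ≡⟨ cong proj₁ pθ+q≡0 ⟩
      0ℚ ∎

  Span-injective : ∀ {θ u v u' v'} → ¬ proj₂ θ ≡ 0ℚ → IsInt u → IsInt v → IsInt u' → IsInt v' →
                   u ⊗ θ ⊕ v ≡ u' ⊗ θ ⊕ v' → u ≡ u' × v ≡ v'
  Span-injective {θ} θ₂≢0 (m , refl) (n , refl) (m' , refl) (n' , refl) e =
    cong [_] (ℤP.i-j≡0⇒i≡j m m' (proj₁ differences≡0)) , cong [_] (ℤP.i-j≡0⇒i≡j n n' (proj₂ differences≡0))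
    where
    open ≡-Reasoning
    open K-Solver
    differences≡0 = Span-independent θ₂≢0 (m ℤ.- m') (n ℤ.- n') (begin
      [ m ℤ.- m' ] ⊗ θ ⊕ [ n ℤ.- n' ]               ≡⟨ cong₂ (λ s t → s ⊗ θ ⊕ t) (ιK-⊖ m m') (ιK-⊖ n n') ⟩
      ([ m ] ⊖ [ m' ]) ⊗ θ ⊕ ([ n ] ⊖ [ n' ])       ≡⟨ solve 5 (λ u v u' v' θ → (u :- u') :* θ :+ (v :- v')
                                                          := (u :* θ :+ v) :- (u' :* θ :+ v')) refl [ m ] [ n ] [ m' ] [ n' ] θ ⟩
      ([ m ] ⊗ θ ⊕ [ n ]) ⊖ ([ m' ] ⊗ θ ⊕ [ n' ])   ≡⟨ cong (_⊖ ([ m' ] ⊗ θ ⊕ [ n' ])) e ⟩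
      ([ m' ] ⊗ θ ⊕ [ n' ]) ⊖ ([ m' ] ⊗ θ ⊕ [ n' ]) ≡⟨ solve 1 (λ z → z :- z := con (+ 0)) refl ([ m' ] ⊗ θ ⊕ [ n' ]) ⟩
      𝟘                                             ∎)

  τ : K
  τ = (ι D ℚ.* ½ , ½)

  InO-coords : ∀ m n → (ι m ℚ.+ ι n ℚ.* ι D ℚ.* ½ , ι n ℚ.* ½) ≡ [ n ] ⊗ τ ⊕ [ m ]
  InO-coords m n = cong₂ _,_
    (solve 3 (λ m n d → m :+ n :* d :* con ½ := (n :* (d :* con ½) :+ d :* (con 0ℚ :* con ½)) :+ m) refl (ι m) (ι n) (ι D))
    (solve 3 (λ m n d → n :* con ½ := (n :* con ½ :+ con 0ℚ :* (d :* con ½)) :+ con 0ℚ) refl (ι m) (ι n) (ι D))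
    where
    open +-*-Solver

  InO⇒Span-τ : ∀ {x} → InO D x → Span τ x
  InO⇒Span-τ (m , n , refl) = [ n ] , [ m ] , IsInt-ιK n , IsInt-ιK m , InO-coords m n

  Span-τ⇒InO : ∀ {x} → Span τ x → InO D x
  Span-τ⇒InO (_ , _ , (n , refl) , (m , refl) , refl) = m , n , sym (InO-coords m n)

  τ-square : ∀ {k} → + 4 ℤ.* k ≡ D ℤ.* D ℤ.- D → τ ⊗ τ ≡ [ D ] ⊗ τ ⊖ [ k ]
  τ-square {k} 4k≡D²-D = cong₂ _,_ first
    (solve 1 (λ d → (d :* con ½) :* con ½ :+ con ½ :* (d :* con ½) := (d :* con ½ :+ con 0ℚ :* (d :* con ½)) :- con 0ℚ) refl d)
    where
    open +-*-Solver
    open ≡-Reasoning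
    d = ι D
    4ιk≡d²-d : ι (+ 4) ℚ.* ι k ≡ d ℚ.* d ℚ.- d
    4ιk≡d²-d = begin
      ι (+ 4) ℚ.* ι k       ≡⟨ ι-* (+ 4) k ⟨
      ι (+ 4 ℤ.* k)         ≡⟨ cong ι 4k≡D²-D ⟩
      ι (D ℤ.* D ℤ.- D)     ≡⟨ ι-+ (D ℤ.* D) (ℤ.- D) ⟩
      ι (D ℤ.* D) ℚ.+ ι (ℤ.- D) ≡⟨ cong₂ ℚ._+_ (ι-* D D) (ι-neg D) ⟩
      d ℚ.* d ℚ.- d         ∎
    first : (d ℚ.* ½) ℚ.* (d ℚ.* ½) ℚ.+ d ℚ.* (½ ℚ.* ½) ≡ (d ℚ.* (d ℚ.* ½) ℚ.+ d ℚ.* (0ℚ ℚ.* ½)) ℚ.- ι k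
    first = begin
      (d ℚ.* ½) ℚ.* (d ℚ.* ½) ℚ.+ d ℚ.* (½ ℚ.* ½)
        ≡⟨ solve 1 (λ d → (d :* con ½) :* (d :* con ½) :+ d :* (con ½ :* con ½)
                       := (d :* (d :* con ½) :+ d :* (con 0ℚ :* con ½)) :- (d :* d :- d) :* con (+ 1 ℚ./ 4)) refl d ⟩
      (d ℚ.* (d ℚ.* ½) ℚ.+ d ℚ.* (0ℚ ℚ.* ½)) ℚ.- (d ℚ.* d ℚ.- d) ℚ.* (+ 1 ℚ./ 4)
        ≡⟨ cong (λ t → (d ℚ.* (d ℚ.* ½) ℚ.+ d ℚ.* (0ℚ ℚ.* ½)) ℚ.- t ℚ.* (+ 1 ℚ./ 4)) 4ιk≡d²-d ⟨
      (d ℚ.* (d ℚ.* ½) ℚ.+ d ℚ.* (0ℚ ℚ.* ½)) ℚ.- (ι (+ 4) ℚ.* ι k) ℚ.* (+ 1 ℚ./ 4)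
        ≡⟨ cong (λ t → (d ℚ.* (d ℚ.* ½) ℚ.+ d ℚ.* (0ℚ ℚ.* ½)) ℚ.- t)
                (solve 1 (λ k → (con (ι (+ 4)) :* k) :* con (+ 1 ℚ./ 4) := k) refl (ι k)) ⟩
      (d ℚ.* (d ℚ.* ½) ℚ.+ d ℚ.* (0ℚ ℚ.* ½)) ℚ.- ι k ∎

  InO-int : ∀ {x} → IsInt x → InO D x
  InO-int x∈ℤ = Span-τ⇒InO (Span-int x∈ℤ)

  InO-⊝ : ∀ {x} → InO D x → InO D (⊝ x)
  InO-⊝ x∈ = Span-τ⇒InO (Span-⊝ (InO⇒Span-τ x∈))

  InO-⊖ : ∀ {x y} → InO D x → InO D y → InO D (x ⊖ y)
  InO-⊖ x∈ y∈ = Span-τ⇒InO (Span-⊖ (InO⇒Span-τ x∈) (InO⇒Span-τ y∈))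

  InO-⊗ : IsDiscr D → ∀ {x y} → InO D x → InO D y → InO D (x ⊗ y)
  InO-⊗ isDiscr x∈ y∈ with IsDiscr⇒4∣D²-D isDiscr
  ... | k , 4k≡D²-D = Span-τ⇒InO (Span-⊗ (IsInt-ιK D) (IsInt-⊝ (IsInt-ιK k)) (τ-square 4k≡D²-D)
                                         (InO⇒Span-τ x∈) (InO⇒Span-τ y∈))

-- Multiplying subsets of K

module Scaling (D : ℤ) (D<0 : D ℤ.< + 0) where
  open QuadraticField D

  infix  4 _⊆_ _≋_
  infixr 7 _·_

  _⊆_ _≋_ : SubK D → SubK D → Set
  A ⊆ B = ∀ x → A x → B x
  _≋_ = _≐_ D

  _·_ : K → SubK D → SubK D
  _·_ = scale D

  private variable
    A B : SubK D
    λ' μ : K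

  ⊆-antisym : A ⊆ B → B ⊆ A → A ≋ B
  ⊆-antisym A⊆B B⊆A x = A⊆B x , B⊆A x

  ≋⇒⊆ : A ≋ B → A ⊆ B
  ≋⇒⊆ A≋B x = proj₁ (A≋B x)

  ≋-sym : A ≋ B → B ≋ A
  ≋-sym A≋B x = proj₂ (A≋B x) , proj₁ (A≋B x)

  ≋-trans : ∀ {C} → A ≋ B → B ≋ C → A ≋ C
  ≋-trans A≋B B≋C x = (λ a → proj₁ (B≋C x) (proj₁ (A≋B x) a)) , (λ c → proj₂ (A≋B x) (proj₂ (B≋C x) c))

  ∈-· : ∀ λ' {α} → A α → (λ' · A) (λ' ⊗ α)
  ∈-· _ {α} α∈A = α , α∈A , refl

  ·-assoc : ∀ λ' μ → (λ' ⊗ μ) · A ≋ λ' · (μ · A)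
  ·-assoc λ' μ = ⊆-antisym
    (λ { _ (α , α∈A , refl) → μ ⊗ α , ∈-· μ α∈A , ⊗-assoc λ' μ α })
    (λ { _ (_ , (α , α∈A , refl) , refl) → α , α∈A , sym (⊗-assoc λ' μ α) })

  𝟙-· : 𝟙 · A ≋ A
  𝟙-· {A} = ⊆-antisym
    (λ { _ (α , α∈A , refl) → subst A (sym (⊗-identityˡ α)) α∈A })
    (λ x x∈A → x , x∈A , sym (⊗-identityˡ x))

  ·-cancel : ¬ λ' ≡ 𝟘 → λ' · A ≋ λ' · B → A ≋ B
  ·-cancel {λ'} {A} {B} λ'≢0 λA≋λB = ⊆-antisym (cancel λA≋λB) (cancel (≋-sym λA≋λB))
    where
    cancel : ∀ {A B} → λ' · A ≋ λ' · B → A ⊆ B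
    cancel {B = B} λA≋λB x x∈A with ≋⇒⊆ λA≋λB (λ' ⊗ x) (∈-· λ' x∈A)
    ... | β , β∈B , λx≡λβ = subst B (sym (⊗-cancelˡ D<0 λ'≢0 λx≡λβ)) β∈B

  ·-proper : ¬ λ' ≡ 𝟘 → IsProper D A → IsProper D (λ' · A)
  ·-proper {λ'} {A} λ'≢0 A-proper β =
    (λ βλA⊆λA → proj₁ (A-proper β) (λA⇒A βλA⊆λA)) , (λ β∈O → A⇒λA (proj₂ (A-proper β) β∈O))
    where
    λA⇒A : (∀ x → (λ' · A) x → (λ' · A) (β ⊗ x)) → ∀ α → A α → A (β ⊗ α)
    λA⇒A βλA⊆λA α α∈A with βλA⊆λA (λ' ⊗ α) (∈-· λ' α∈A)
    ... | α' , α'∈A , βλα≡λα' = subst A (sym (⊗-cancelˡ D<0 λ'≢0 (trans (x⊗yz≡y⊗xz λ' β α) βλα≡λα'))) α'∈A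
    A⇒λA : (∀ α → A α → A (β ⊗ α)) → ∀ x → (λ' · A) x → (λ' · A) (β ⊗ x)
    A⇒λA βA⊆A _ (α , α∈A , refl) = β ⊗ α , βA⊆A α α∈A , x⊗yz≡y⊗xz β λ' α

  ·-mono : A ⊆ B → λ' · A ⊆ λ' · B
  ·-mono A⊆B _ (α , α∈A , x≡λα) = α , A⊆B α α∈A , x≡λα

-- Classes of a proper 𝒪-module

record IsProperModule (D : ℤ) (L : SubK D) : Set where
  field
    𝟙∈ : L (1K D)
    ⊕-closed : ∀ {x y} → L x → L y → L (_+K_ D x y)
    proper : IsProper D L

module Classes (D : ℤ) (D<0 : D ℤ.< + 0) (isDiscr : IsDiscr D) (N : ℕ)
               {L : SubK D} (L-proper : IsProperModule D L) where
  open QuadraticField D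
  open Scaling D D<0
  open IsProperModule L-proper
  open K-Solver

  private variable
    A B : SubK D
    λ' μ ν ζ : K

  O·L⊆L : ∀ {β α} → InO D β → L α → L (β ⊗ α)
  O·L⊆L {β} {α} β∈O α∈L = proj₂ (proper β) β∈O α α∈L

  O⊆L : ∀ {x} → InO D x → L x
  O⊆L {x} x∈O = subst L (⊗-identityʳ x) (O·L⊆L x∈O 𝟙∈)

  Colon : K → Set
  Colon λ' = ∀ α → L α → InO D (λ' ⊗ α)

  -- The set P of the theorem with λ ∈ a𝔠̄ replaced by λL ⊆ 𝒪; for L = 𝔠 the two agree
  -- (FormLattice.a𝔠̄⇒colon, FormLattice.colon⇒a𝔠̄).
  PColon : K → Set
  PColon λ' = Colon λ' × ¬ λ' ≡ 𝟘 × Cong1 D N λ'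

  Colon⇒InO : Colon λ' → InO D λ'
  Colon⇒InO {λ'} λ'L⊆O = subst (InO D) (⊗-identityʳ λ') (λ'L⊆O 𝟙 𝟙∈)

  𝟙≢𝟘 : ¬ 𝟙 ≡ 𝟘
  𝟙≢𝟘 𝟙≡𝟘 = ℚP.1≢0 (cong proj₁ 𝟙≡𝟘)

  Cong1-𝟙 : Cong1 D N 𝟙
  Cong1-𝟙 = 𝟘 , InO-int (IsInt-ιK (+ 0)) , solve 1 (λ n → con (+ 1) :- con (+ 1) := n :* con (+ 0)) refl [ + N ]

  Cong1-quotient : ∀ ν → InO D ζ → Cong1 D N ν → Cong1 D N (ν ⊗ ζ) → Cong1 D N ζ
  Cong1-quotient {ζ} ν ζ∈O (γ , γ∈O , ν-1≡Nγ) (γ' , γ'∈O , νζ-1≡Nγ') =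
    γ' ⊖ ζ ⊗ γ , InO-⊖ γ'∈O (InO-⊗ isDiscr ζ∈O γ∈O) , (begin
      ζ ⊖ 𝟙                        ≡⟨ solve 2 (λ ζ ν → ζ :- con (+ 1) := (ν :* ζ :- con (+ 1)) :- ζ :* (ν :- con (+ 1)))
                                             refl ζ ν ⟩
      (ν ⊗ ζ ⊖ 𝟙) ⊖ ζ ⊗ (ν ⊖ 𝟙)    ≡⟨ cong₂ (λ s t → s ⊖ ζ ⊗ t) νζ-1≡Nγ' ν-1≡Nγ ⟩
      [ + N ] ⊗ γ' ⊖ ζ ⊗ ([ + N ] ⊗ γ) ≡⟨ solve 4 (λ n γ' ζ γ → n :* γ' :- ζ :* (n :* γ) := n :* (γ' :- ζ :* γ))
                                             refl [ + N ] γ' ζ γ ⟩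
      [ + N ] ⊗ (γ' ⊖ ζ ⊗ γ)       ∎)
    where
    open ≡-Reasoning

  IsProper-≋ : A ≋ B → IsProper D B → IsProper D A
  IsProper-≋ A≋B B-proper β =
      (λ βA⊆A → proj₁ (B-proper β) (λ α α∈B → to _ (βA⊆A α (from α α∈B))))
    , (λ β∈O α α∈A → from _ (proj₂ (B-proper β) β∈O α (to α α∈A)))
    where
    to = ≋⇒⊆ A≋B
    from = ≋⇒⊆ (≋-sym A≋B)

  InM-≋ : A ≋ B → InM D N B → InM D N A
  InM-≋ A≋B ((B⊆O , 𝟘∈B , ⊕∈B , O·B⊆B) , (x , x∈B , x≢0) , B-proper , B-coprime) =
      ( (λ x x∈A → B⊆O x (to x x∈A))
      , from 𝟘 𝟘∈B
      , (λ x y x∈A y∈A → from _ (⊕∈B x y (to x x∈A) (to y y∈A)))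
      , (λ r x r∈O x∈A → from _ (O·B⊆B r x r∈O (to x x∈A))))
    , (x , from x x∈B , x≢0)
    , IsProper-≋ A≋B B-proper
    , λ x x∈O → let (α , γ , α∈B , γ∈O , x≡α+Nγ) = B-coprime x x∈O in α , γ , from α α∈B , γ∈O , x≡α+Nγ
    where
    to = ≋⇒⊆ A≋B
    from = ≋⇒⊆ (≋-sym A≋B)

  InM-scale : PColon λ' → InM D N (λ' · L)
  InM-scale {λ'} (λ'L⊆O , λ'≢0 , (γ , γ∈O , λ'-1≡Nγ)) =
      ( (λ { _ (α , α∈L , refl) → λ'L⊆O α α∈L })
      , (𝟘 , O⊆L (InO-int (IsInt-ιK (+ 0))) , solve 1 (λ l → con (+ 0) := l :* con (+ 0)) refl λ')
      , (λ { _ _ (α , α∈L , refl) (β , β∈L , refl) → α ⊕ β , ⊕-closed α∈L β∈L , sym (⊗-distribˡ-⊕ λ' α β) })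
      , (λ { r _ r∈O (α , α∈L , refl) → r ⊗ α , O·L⊆L r∈O α∈L , x⊗yz≡y⊗xz r λ' α }))
    , (λ' , (𝟙 , 𝟙∈ , sym (⊗-identityʳ λ')) , λ'≢0)
    , ·-proper λ'≢0 proper
    , λ x x∈O → λ' ⊗ x , ⊝ (γ ⊗ x) , ∈-· λ' (O⊆L x∈O) , InO-⊝ (InO-⊗ isDiscr γ∈O x∈O) , (begin
        x                                ≡⟨ solve 2 (λ x l → x := l :* x :+ :- ((l :- con (+ 1)) :* x)) refl x λ' ⟩
        λ' ⊗ x ⊕ ⊝ ((λ' ⊖ 𝟙) ⊗ x)        ≡⟨ cong (λ t → λ' ⊗ x ⊕ ⊝ (t ⊗ x)) λ'-1≡Nγ ⟩
        λ' ⊗ x ⊕ ⊝ (([ + N ] ⊗ γ) ⊗ x)   ≡⟨ solve 4 (λ x l n γ → l :* x :+ :- ((n :* γ) :* x) := l :* x :+ n :* (:- (γ :* x)))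
                                                    refl x λ' [ + N ] γ ⟩
        λ' ⊗ x ⊕ [ + N ] ⊗ ⊝ (γ ⊗ x)     ∎)
    where
    open ≡-Reasoning

  stabiliser-in-O : ζ · L ≋ L → InO D ζ
  stabiliser-in-O {ζ} ζL≋L = proj₁ (proper ζ) (λ α α∈L → ≋⇒⊆ ζL≋L (ζ ⊗ α) (∈-· ζ α∈L))

  ratio : ¬ λ' ≡ 𝟘 → λ' · L ≋ μ · L → ∃[ ζ ] (InO D ζ × μ ≡ λ' ⊗ ζ)
  ratio {λ'} {μ} λ'≢0 λ'L≋μL =
    let (ζ , _ , μ≡λ'ζ) = μ∈λ'L in ζ , stabiliser-in-O (≋-sym (L≋ζL ζ μ≡λ'ζ)) , μ≡λ'ζ
    where
    μ∈λ'L : (λ' · L) μ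
    μ∈λ'L = ≋⇒⊆ (≋-sym λ'L≋μL) μ (subst (μ · L) (⊗-identityʳ μ) (∈-· μ 𝟙∈))
    L≋ζL : ∀ ζ → μ ≡ λ' ⊗ ζ → L ≋ ζ · L
    L≋ζL ζ μ≡λ'ζ = ·-cancel λ'≢0 (≋-trans λ'L≋μL (subst (λ κ → κ · L ≋ λ' · (ζ · L)) (sym μ≡λ'ζ) (·-assoc λ' ζ)))

  factor-⊆ : ∀ λ' → InO D ζ → (λ' ⊗ ζ) · L ⊆ λ' · L
  factor-⊆ {ζ} λ' ζ∈O x x∈λζL = ·-mono {λ' = λ'} (λ { _ (α , α∈L , refl) → O·L⊆L ζ∈O α∈L }) x (≋⇒⊆ (·-assoc λ' ζ) x x∈λζL)

  class⇒scale : SameClass D N A L × InM D N A → ∃[ λ' ] (PColon λ' × A ≋ λ' · L)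
  class⇒scale {A} ((ν , μ , (_ , ν≢0 , ν≡1) , (_ , μ≢0 , μ≡1) , νA≋μL) , ((A⊆O , _) , _)) =
    generator (≋⇒⊆ (≋-sym νA≋μL) μ (subst (μ · L) (⊗-identityʳ μ) (∈-· μ 𝟙∈)))
    where
    generator : (ν · A) μ → ∃[ λ' ] (PColon λ' × A ≋ λ' · L)
    generator (α₀ , α₀∈A , μ≡να₀) = α₀ , (α₀L⊆O , α₀≢0 , α₀≡1) , A≋α₀L
      where
      A≋α₀L : A ≋ α₀ · L
      A≋α₀L = ·-cancel ν≢0 (≋-trans νA≋μL (subst (λ κ → κ · L ≋ ν · (α₀ · L)) (sym μ≡να₀) (·-assoc ν α₀)))
      α₀L⊆O : Colon α₀
      α₀L⊆O α α∈L = A⊆O (α₀ ⊗ α) (≋⇒⊆ (≋-sym A≋α₀L) (α₀ ⊗ α) (∈-· α₀ α∈L))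
      α₀≢0 : ¬ α₀ ≡ 𝟘
      α₀≢0 refl = μ≢0 (trans μ≡να₀ (solve 1 (λ ν → ν :* con (+ 0) := con (+ 0)) refl ν))
      α₀≡1 : Cong1 D N α₀
      α₀≡1 = Cong1-quotient ν (A⊆O α₀ α₀∈A) ν≡1 (subst (Cong1 D N) μ≡να₀ μ≡1)

  scale⇒class : PColon λ' → A ≋ λ' · L → SameClass D N A L × InM D N A
  scale⇒class P@(λ'L⊆O , λ'≢0 , λ'≡1) A≋λ'L =
      (𝟙 , _ , (InO-int (IsInt-ιK (+ 1)) , 𝟙≢𝟘 , Cong1-𝟙) , (Colon⇒InO λ'L⊆O , λ'≢0 , λ'≡1) , ≋-trans 𝟙-· A≋λ'L)
    , InM-≋ A≋λ'L (InM-scale P)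

  inverse-ratios : ∀ {η} → ¬ λ' ≡ 𝟘 → μ ≡ λ' ⊗ ζ → λ' ≡ μ ⊗ η → ζ ⊗ η ≡ 𝟙
  inverse-ratios {λ'} {μ} {ζ} {η} λ'≢0 μ≡λ'ζ λ'≡μη = ⊗-cancelˡ D<0 λ'≢0 (begin
    λ' ⊗ (ζ ⊗ η)    ≡⟨ ⊗-assoc λ' ζ η ⟨
    (λ' ⊗ ζ) ⊗ η    ≡⟨ cong (_⊗ η) μ≡λ'ζ ⟨
    μ ⊗ η           ≡⟨ λ'≡μη ⟨
    λ'              ≡⟨ ⊗-identityʳ λ' ⟨
    λ' ⊗ 𝟙          ∎)
    where
    open ≡-Reasoning

  same-scale⇒unit : ¬ λ' ≡ 𝟘 → ¬ μ ≡ 𝟘 → Cong1 D N λ' → Cong1 D N μ → λ' · L ≋ μ · L →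
                    ∃[ ζ ] (IsUnit D ζ × Cong1 D N ζ × μ ≡ ζ ⊗ λ')
  same-scale⇒unit {λ'} {μ} λ'≢0 μ≢0 λ'≡1 μ≡1 λ'L≋μL =
    let (ζ , ζ∈O , μ≡λ'ζ) = ratio λ'≢0 λ'L≋μL
        (η , η∈O , λ'≡μη) = ratio μ≢0 (≋-sym λ'L≋μL)
    in ζ , (ζ∈O , η , η∈O , inverse-ratios λ'≢0 μ≡λ'ζ λ'≡μη)
         , Cong1-quotient λ' ζ∈O λ'≡1 (subst (Cong1 D N) μ≡λ'ζ μ≡1)
         , trans μ≡λ'ζ (⊗-comm λ' ζ)

  unit⇒same-scale : IsUnit D ζ → μ ≡ ζ ⊗ λ' → λ' · L ≋ μ · L
  unit⇒same-scale {ζ} {μ} {λ'} (ζ∈O , η , η∈O , ζη≡1) μ≡ζλ' = ⊆-antisym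
    (subst (λ κ → κ · L ⊆ μ · L) λ'≡μη (factor-⊆ μ η∈O))
    (subst (λ κ → κ · L ⊆ λ' · L) (sym μ≡λ'ζ) (factor-⊆ λ' ζ∈O))
    where
    open ≡-Reasoning
    μ≡λ'ζ : μ ≡ λ' ⊗ ζ
    μ≡λ'ζ = trans μ≡ζλ' (⊗-comm ζ λ')
    λ'≡μη : μ ⊗ η ≡ λ'
    λ'≡μη = begin
      μ ⊗ η            ≡⟨ cong (_⊗ η) μ≡λ'ζ ⟩
      (λ' ⊗ ζ) ⊗ η     ≡⟨ ⊗-assoc λ' ζ η ⟩
      λ' ⊗ (ζ ⊗ η)     ≡⟨ cong (λ' ⊗_) ζη≡1 ⟩
      λ' ⊗ 𝟙           ≡⟨ ⊗-identityʳ λ' ⟩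
      λ'               ∎

-- The lattice of a quadratic form

module FormLattice (D : ℤ) (a₀ : ℕ) (b c : ℤ)
                   (disc : b ℤ.* b ℤ.- + 4 ℤ.* + ℕ.suc a₀ ℤ.* c ≡ D)
                   (gcd≡1 : gcd (gcd (+ ℕ.suc a₀) b) c ≡ + 1) where
  open QuadraticField D

  a : ℤ
  a = + ℕ.suc a₀

  ω θ : K
  ω = ωQ D a b
  θ = [ a ] ⊗ ω

  𝔠 : SubK D
  𝔠 = Lat D a b

  module _ where
    open +-*-Solver
    open ≡-Reasoning

    private
      β γ d i : ℚ
      β = ι b
      γ = ι c
      d = ι D
      i = inv2 a

    θ-coords : θ ≡ (ℚ.- β ℚ.* ½ , ½)
    θ-coords = cong₂ _,_
      (begin
        ι a ℚ.* (ℚ.- β ℚ.* i) ℚ.+ d ℚ.* (0ℚ ℚ.* i) ≡⟨ solve 4 (λ α β i d → α :* (:- β :* i) :+ d :* (con 0ℚ :* i)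
                                                                 := :- β :* (α :* i)) refl (ι a) β i d ⟩
        ℚ.- β ℚ.* (ι a ℚ.* i)                      ≡⟨ cong (ℚ.- β ℚ.*_) (ι-*-inv2 a₀) ⟩
        ℚ.- β ℚ.* ½                                ∎)
      (begin
        ι a ℚ.* i ℚ.+ 0ℚ ℚ.* (ℚ.- β ℚ.* i)         ≡⟨ solve 3 (λ α β i → α :* i :+ con 0ℚ :* (:- β :* i) := α :* i)
                                                           refl (ι a) β i ⟩
        ι a ℚ.* i                                  ≡⟨ ι-*-inv2 a₀ ⟩
        ½                                          ∎)

    ω₂≢0 : ¬ proj₂ ω ≡ 0ℚ
    ω₂≢0 i≡0 = ½≢0 (trans (sym (ι-*-inv2 a₀)) (trans (cong (ι a ℚ.*_) i≡0) (ℚP.*-zeroʳ (ι a))))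

    ι-disc : d ≡ β ℚ.* β ℚ.- ι (+ 4) ℚ.* ι a ℚ.* γ
    ι-disc = begin
      d                                              ≡⟨ cong ι disc ⟨
      ι (b ℤ.* b ℤ.- + 4 ℤ.* a ℤ.* c)                ≡⟨ ι-+ (b ℤ.* b) (ℤ.- (+ 4 ℤ.* a ℤ.* c)) ⟩
      ι (b ℤ.* b) ℚ.+ ι (ℤ.- (+ 4 ℤ.* a ℤ.* c))      ≡⟨ cong₂ ℚ._+_ (ι-* b b) (ι-neg (+ 4 ℤ.* a ℤ.* c)) ⟩
      β ℚ.* β ℚ.- ι (+ 4 ℤ.* a ℤ.* c)                ≡⟨ cong (λ t → β ℚ.* β ℚ.- t)
                                                          (trans (ι-* (+ 4 ℤ.* a) c) (cong (ℚ._* γ) (ι-* (+ 4) a))) ⟩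
      β ℚ.* β ℚ.- ι (+ 4) ℚ.* ι a ℚ.* γ              ∎

    τ⊖θ-integral : ∃[ h ] (τ ⊖ θ ≡ [ h ])
    τ⊖θ-integral =
      let (h , b+D≡2h) = discriminant-parity b a c in
      h , trans (cong (τ ⊖_) θ-coords) (cong₂ _,_ (begin
        d ℚ.* ½ ℚ.- ℚ.- β ℚ.* ½        ≡⟨ solve 2 (λ d β → d :* con ½ :- :- β :* con ½ := (β :+ d) :* con ½) refl d β ⟩
        (β ℚ.+ d) ℚ.* ½               ≡⟨ cong (ℚ._* ½) (ι-+ b D) ⟨
        ι (b ℤ.+ D) ℚ.* ½             ≡⟨ cong (λ t → ι (b ℤ.+ t) ℚ.* ½) disc ⟨
        ι (b ℤ.+ (b ℤ.* b ℤ.- + 4 ℤ.* a ℤ.* c)) ℚ.* ½ ≡⟨ cong (λ t → ι t ℚ.* ½) b+D≡2h ⟩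
        ι (+ 2 ℤ.* h) ℚ.* ½           ≡⟨ cong (ℚ._* ½) (ι-* (+ 2) h) ⟩
        ι (+ 2) ℚ.* ι h ℚ.* ½         ≡⟨ solve 1 (λ h → con (ι (+ 2)) :* h :* con ½ := h) refl (ι h) ⟩
        ι h                           ∎)
        (ℚP.+-inverseʳ ½))

    θ⊗ω : θ ⊗ ω ≡ ⊝ ([ b ] ⊗ ω ⊕ [ c ])
    θ⊗ω = trans (cong (_⊗ ω) θ-coords) (cong₂ _,_
      (begin
        (ℚ.- β ℚ.* ½) ℚ.* (ℚ.- β ℚ.* i) ℚ.+ d ℚ.* (½ ℚ.* i)
          ≡⟨ cong (λ t → (ℚ.- β ℚ.* ½) ℚ.* (ℚ.- β ℚ.* i) ℚ.+ t ℚ.* (½ ℚ.* i)) ι-disc ⟩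
        (ℚ.- β ℚ.* ½) ℚ.* (ℚ.- β ℚ.* i) ℚ.+ (β ℚ.* β ℚ.- ι (+ 4) ℚ.* ι a ℚ.* γ) ℚ.* (½ ℚ.* i)
          ≡⟨ solve 5 (λ β α γ i d → (:- β :* con ½) :* (:- β :* i) :+ (β :* β :- con (ι (+ 4)) :* α :* γ) :* (con ½ :* i)
                                 := :- ((β :* (:- β :* i) :+ d :* (con 0ℚ :* i)) :+ γ :* (con (ι (+ 2)) :* (α :* i))))
                     refl β (ι a) γ i d ⟩
        ℚ.- ((β ℚ.* (ℚ.- β ℚ.* i) ℚ.+ d ℚ.* (0ℚ ℚ.* i)) ℚ.+ γ ℚ.* (ι (+ 2) ℚ.* (ι a ℚ.* i)))
          ≡⟨ cong (λ t → ℚ.- ((β ℚ.* (ℚ.- β ℚ.* i) ℚ.+ d ℚ.* (0ℚ ℚ.* i)) ℚ.+ γ ℚ.* (ι (+ 2) ℚ.* t))) (ι-*-inv2 a₀) ⟩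
        ℚ.- ((β ℚ.* (ℚ.- β ℚ.* i) ℚ.+ d ℚ.* (0ℚ ℚ.* i)) ℚ.+ γ ℚ.* (ι (+ 2) ℚ.* ½))
          ≡⟨ solve 4 (λ β γ i d → :- ((β :* (:- β :* i) :+ d :* (con 0ℚ :* i)) :+ γ :* (con (ι (+ 2)) :* con ½))
                               := :- ((β :* (:- β :* i) :+ d :* (con 0ℚ :* i)) :+ γ)) refl β γ i d ⟩
        ℚ.- ((β ℚ.* (ℚ.- β ℚ.* i) ℚ.+ d ℚ.* (0ℚ ℚ.* i)) ℚ.+ γ)
          ∎)
      (solve 2 (λ β i → (:- β :* con ½) :* i :+ con ½ :* (:- β :* i) := :- ((β :* i :+ con 0ℚ :* (:- β :* i)) :+ con 0ℚ))
         refl β i))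

    conj-θ : conj D θ ≡ ⊝ ([ b ] ⊕ θ)
    conj-θ = begin
      conj D θ                        ≡⟨ cong (conj D) θ-coords ⟩
      (ℚ.- β ℚ.* ½ , ℚ.- ½)           ≡⟨ cong₂ _,_ (solve 1 (λ β → :- β :* con ½ := :- (β :+ :- β :* con ½)) refl β)
                                                   (solve 0 (:- con ½ := :- (con 0ℚ :+ con ½)) refl) ⟩
      ⊝ ([ b ] ⊕ (ℚ.- β ℚ.* ½ , ½))   ≡⟨ cong (λ t → ⊝ ([ b ] ⊕ t)) θ-coords ⟨
      ⊝ ([ b ] ⊕ θ)                   ∎

  open K-Solver
  open ≡-Reasoning

  InO⇒Span-θ : ∀ {x} → InO D x → Span θ x
  InO⇒Span-θ x∈O = let (h , τ-θ≡h) = τ⊖θ-integral in Span-shift (h , τ-θ≡h) (InO⇒Span-τ x∈O)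

  Span-θ⇒InO : ∀ {x} → Span θ x → InO D x
  Span-θ⇒InO x∈ =
    let (h , τ-θ≡h) = τ⊖θ-integral
        θ-τ≡-h = trans (solve 2 (λ θ τ → θ :- τ := :- (τ :- θ)) refl θ τ) (cong ⊝_ τ-θ≡h)
    in Span-τ⇒InO (Span-shift (subst IsInt (sym θ-τ≡-h) (IsInt-⊝ (IsInt-ιK h))) x∈)

  𝔠⇒Span-ω : ∀ {x} → 𝔠 x → Span ω x
  𝔠⇒Span-ω (m , n , x≡) = [ m ] , [ n ] , IsInt-ιK m , IsInt-ιK n , x≡

  Span-ω⇒𝔠 : ∀ {x} → Span ω x → 𝔠 x
  Span-ω⇒𝔠 (_ , _ , (m , refl) , (n , refl) , x≡) = m , n , x≡

  O·𝔠⊆𝔠 : ∀ {β α} → InO D β → 𝔠 α → 𝔠 (β ⊗ α)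
  O·𝔠⊆𝔠 β∈O α∈𝔠 = Span-ω⇒𝔠 (Span-module θ∈ θω∈ (InO⇒Span-θ β∈O) (𝔠⇒Span-ω α∈𝔠))
    where
    θ∈ : Span ω θ
    θ∈ = [ a ] , 𝟘 , IsInt-ιK a , IsInt-ιK (+ 0) , solve 1 (λ x → x := x :+ con (+ 0)) refl θ
    θω∈ : Span ω (θ ⊗ ω)
    θω∈ = subst (Span ω) (sym θ⊗ω) (Span-⊝ ([ b ] , [ c ] , IsInt-ιK b , IsInt-ιK c , refl))

  𝟙∈𝔠 : 𝔠 𝟙
  𝟙∈𝔠 = + 0 , + 1 , solve 1 (λ ω → con (+ 1) := con (+ 0) :* ω :+ con (+ 1)) refl ω

  ω∈𝔠 : 𝔠 ω
  ω∈𝔠 = + 1 , + 0 , solve 1 (λ ω → ω := con (+ 1) :* ω :+ con (+ 0)) refl ω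

  ⊗ω-coords : ∀ u v → (u ⊗ θ ⊕ v) ⊗ ω ≡ (v ⊖ u ⊗ [ b ]) ⊗ ω ⊕ ⊝ (u ⊗ [ c ])
  ⊗ω-coords u v = begin
    (u ⊗ θ ⊕ v) ⊗ ω                  ≡⟨ solve 4 (λ u v θ ω → (u :* θ :+ v) :* ω := u :* (θ :* ω) :+ v :* ω) refl u v θ ω ⟩
    u ⊗ (θ ⊗ ω) ⊕ v ⊗ ω              ≡⟨ cong (λ t → u ⊗ t ⊕ v ⊗ ω) θ⊗ω ⟩
    u ⊗ ⊝ ([ b ] ⊗ ω ⊕ [ c ]) ⊕ v ⊗ ω ≡⟨ solve 5 (λ u v B C ω → u :* (:- (B :* ω :+ C)) :+ v :* ω
                                                          := (v :- u :* B) :* ω :+ :- (u :* C)) refl u v [ b ] [ c ] ω ⟩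
    (v ⊖ u ⊗ [ b ]) ⊗ ω ⊕ ⊝ (u ⊗ [ c ]) ∎

  multiplier-equations : ∀ M n M₂ n₂ → ([ M ] ⊗ ω ⊕ [ n ]) ⊗ ω ≡ [ M₂ ] ⊗ ω ⊕ [ n₂ ] →
                         a ℤ.* n ℤ.- M ℤ.* b ≡ a ℤ.* M₂ × ℤ.- (M ℤ.* c) ≡ a ℤ.* n₂
  multiplier-equations M n M₂ n₂ βω≡ =
      ιK-injective (begin
        [ a ℤ.* n ℤ.- M ℤ.* b ]        ≡⟨ trans (ιK-⊖ (a ℤ.* n) (M ℤ.* b)) (cong₂ _⊖_ (ιK-* a n) (ιK-* M b)) ⟩
        [ a ] ⊗ [ n ] ⊖ [ M ] ⊗ [ b ]  ≡⟨ proj₁ coefficients ⟩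
        [ a ] ⊗ [ M₂ ]                 ≡⟨ ιK-* a M₂ ⟨
        [ a ℤ.* M₂ ]                   ∎)
    , ιK-injective (begin
        [ ℤ.- (M ℤ.* c) ]              ≡⟨ trans (ιK-neg (M ℤ.* c)) (cong ⊝_ (ιK-* M c)) ⟩
        ⊝ ([ M ] ⊗ [ c ])              ≡⟨ proj₂ coefficients ⟩
        [ a ] ⊗ [ n₂ ]                 ≡⟨ ιK-* a n₂ ⟨
        [ a ℤ.* n₂ ]                   ∎)
    where
    coefficients = Span-injective ω₂≢0
      (IsInt-⊖ (IsInt-⊗ (IsInt-ιK a) (IsInt-ιK n)) (IsInt-⊗ (IsInt-ιK M) (IsInt-ιK b)))
      (IsInt-⊝ (IsInt-⊗ (IsInt-ιK M) (IsInt-ιK c))) (IsInt-⊗ (IsInt-ιK a) (IsInt-ιK M₂)) (IsInt-⊗ (IsInt-ιK a) (IsInt-ιK n₂))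
      (begin
        ([ a ] ⊗ [ n ] ⊖ [ M ] ⊗ [ b ]) ⊗ ω ⊕ ⊝ ([ M ] ⊗ [ c ]) ≡⟨ ⊗ω-coords [ M ] ([ a ] ⊗ [ n ]) ⟨
        ([ M ] ⊗ θ ⊕ [ a ] ⊗ [ n ]) ⊗ ω                       ≡⟨ solve 4 (λ M n A ω → (M :* (A :* ω) :+ A :* n) :* ω
                                                                               := A :* ((M :* ω :+ n) :* ω)) refl [ M ] [ n ] [ a ] ω ⟩
        [ a ] ⊗ (([ M ] ⊗ ω ⊕ [ n ]) ⊗ ω)                     ≡⟨ cong ([ a ] ⊗_) βω≡ ⟩
        [ a ] ⊗ ([ M₂ ] ⊗ ω ⊕ [ n₂ ])                         ≡⟨ solve 4 (λ A M₂ ω n₂ → A :* (M₂ :* ω :+ n₂) := (A :* M₂) :* ω :+ A :* n₂)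
                                                                   refl [ a ] [ M₂ ] ω [ n₂ ] ⟩
        ([ a ] ⊗ [ M₂ ]) ⊗ ω ⊕ [ a ] ⊗ [ n₂ ]                 ∎)

  multiplier⇒O : ∀ {β} → 𝔠 β → 𝔠 (β ⊗ ω) → InO D β
  multiplier⇒O (M , n , refl) (M₂ , n₂ , βω≡) =
    let (an-Mb≡aM₂ , -Mc≡an₂) = multiplier-equations M n M₂ n₂ βω≡
        a∣Mc = ℤDS.divides (ℤ.- n₂) (trans (sym (ℤP.neg-involutive (M ℤ.* c)))
                 (trans (cong ℤ.-_ -Mc≡an₂) (trans (ℤP.neg-distribʳ-* a n₂) (ℤP.*-comm a (ℤ.- n₂)))))
        ℤDS.divides q M≡qa = primitive-divisor {b = b} {c} {M} gcd≡1 (∣-via-difference n M₂ an-Mb≡aM₂) a∣Mc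
    in Span-θ⇒InO ([ q ] , [ n ] , IsInt-ιK q , IsInt-ιK n , (begin
         [ M ] ⊗ ω ⊕ [ n ]          ≡⟨ cong (λ t → t ⊗ ω ⊕ [ n ]) (trans (cong [_] M≡qa) (ιK-* q a)) ⟩
         ([ q ] ⊗ [ a ]) ⊗ ω ⊕ [ n ] ≡⟨ cong (_⊕ [ n ]) (⊗-assoc [ q ] [ a ] ω) ⟩
         [ q ] ⊗ θ ⊕ [ n ]          ∎))

  𝔠-isProperModule : IsProperModule D 𝔠
  𝔠-isProperModule = record
    { 𝟙∈ = 𝟙∈𝔠
    ; ⊕-closed = λ x∈ y∈ → Span-ω⇒𝔠 (Span-⊕ (𝔠⇒Span-ω x∈) (𝔠⇒Span-ω y∈))
    ; proper = λ β → (λ β𝔠⊆𝔠 → multiplier⇒O (subst 𝔠 (⊗-identityʳ β) (β𝔠⊆𝔠 𝟙 𝟙∈𝔠)) (β𝔠⊆𝔠 ω ω∈𝔠))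
                   , (λ β∈O α α∈𝔠 → O·𝔠⊆𝔠 β∈O α∈𝔠)
    }

  a·conj : ∀ m n → [ a ] ⊗ conj D ([ m ] ⊗ ω ⊕ [ n ]) ≡ ⊝ [ m ] ⊗ θ ⊕ ([ a ] ⊗ [ n ] ⊖ [ m ] ⊗ [ b ])
  a·conj m n = begin
    [ a ] ⊗ conj D ([ m ] ⊗ ω ⊕ [ n ])
      ≡⟨ cong ([ a ] ⊗_) (trans (conj-⊕ ([ m ] ⊗ ω) [ n ]) (cong (_⊕ [ n ]) (conj-⊗ [ m ] ω))) ⟩
    [ a ] ⊗ ([ m ] ⊗ conj D ω ⊕ [ n ])
      ≡⟨ solve 4 (λ A M ω̄ n → A :* (M :* ω̄ :+ n) := M :* (A :* ω̄) :+ A :* n) refl [ a ] [ m ] (conj D ω) [ n ] ⟩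
    [ m ] ⊗ ([ a ] ⊗ conj D ω) ⊕ [ a ] ⊗ [ n ]
      ≡⟨ cong (λ t → [ m ] ⊗ t ⊕ [ a ] ⊗ [ n ]) (trans (sym (conj-⊗ [ a ] ω)) conj-θ) ⟩
    [ m ] ⊗ ⊝ ([ b ] ⊕ θ) ⊕ [ a ] ⊗ [ n ]
      ≡⟨ solve 5 (λ M B θ A n → M :* (:- (B :+ θ)) :+ A :* n := (:- M) :* θ :+ (A :* n :- M :* B))
           refl [ m ] [ b ] θ [ a ] [ n ] ⟩
    ⊝ [ m ] ⊗ θ ⊕ ([ a ] ⊗ [ n ] ⊖ [ m ] ⊗ [ b ]) ∎

  colon-from-basis : ∀ {λ'} → Span θ λ' → Span θ (λ' ⊗ ω) → ∀ α → 𝔠 α → InO D (λ' ⊗ α)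
  colon-from-basis {λ'} λ'∈ λ'ω∈ _ (k , l , refl) = Span-θ⇒InO (subst (Span θ)
    (solve 4 (λ λ' ω k l → k :* (λ' :* ω) :+ l :* λ' := λ' :* (k :* ω :+ l)) refl λ' ω [ k ] [ l ])
    (Span-⊕ (Span-scale (IsInt-ιK k) λ'ω∈) (Span-scale (IsInt-ιK l) λ'∈)))

  a𝔠̄⇒colon : ∀ {λ'} → ∃[ x ] (𝔠 x × λ' ≡ [ a ] ⊗ conj D x) → ∀ α → 𝔠 α → InO D (λ' ⊗ α)
  a𝔠̄⇒colon (_ , (m , n , refl) , refl) = colon-from-basis
    (subst (Span θ) (sym (a·conj m n)) (⊝ [ m ] , _ , IsInt-⊝ (IsInt-ιK m) , IsInt-⊖ (IsInt-⊗ (IsInt-ιK a) (IsInt-ιK n)) (IsInt-⊗ (IsInt-ιK m) (IsInt-ιK b)) , refl))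
    ([ n ] , [ m ] ⊗ [ c ] , IsInt-ιK n , IsInt-⊗ (IsInt-ιK m) (IsInt-ιK c) , (begin
      ([ a ] ⊗ conj D ([ m ] ⊗ ω ⊕ [ n ])) ⊗ ω
        ≡⟨ cong (_⊗ ω) (a·conj m n) ⟩
      (⊝ [ m ] ⊗ θ ⊕ ([ a ] ⊗ [ n ] ⊖ [ m ] ⊗ [ b ])) ⊗ ω
        ≡⟨ ⊗ω-coords (⊝ [ m ]) ([ a ] ⊗ [ n ] ⊖ [ m ] ⊗ [ b ]) ⟩
      ([ a ] ⊗ [ n ] ⊖ [ m ] ⊗ [ b ] ⊖ ⊝ [ m ] ⊗ [ b ]) ⊗ ω ⊕ ⊝ (⊝ [ m ] ⊗ [ c ])
        ≡⟨ solve 6 (λ A n M B C ω → (A :* n :- M :* B :- (:- M) :* B) :* ω :+ :- ((:- M) :* C) := n :* (A :* ω) :+ M :* C)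
             refl [ a ] [ n ] [ m ] [ b ] [ c ] ω ⟩
      [ n ] ⊗ θ ⊕ [ m ] ⊗ [ c ] ∎))

  colon⇒a𝔠̄ : ∀ {λ'} → (∀ α → 𝔠 α → InO D (λ' ⊗ α)) → ∃[ x ] (𝔠 x × λ' ≡ [ a ] ⊗ conj D x)
  colon⇒a𝔠̄ {λ'} λ'𝔠⊆O = from-coords (InO⇒Span-θ (subst (InO D) (⊗-identityʳ λ') (λ'𝔠⊆O 𝟙 𝟙∈𝔠)))
                                      (InO⇒Span-θ (λ'𝔠⊆O ω ω∈𝔠))
    where
    from-coords : ∀ {λ'} → Span θ λ' → Span θ (λ' ⊗ ω) → ∃[ x ] (𝔠 x × λ' ≡ [ a ] ⊗ conj D x)
    from-coords (_ , _ , (p , refl) , (q , refl) , refl) (_ , _ , (p' , refl) , (q' , refl) , λ'ω≡) =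
      [ ℤ.- p ] ⊗ ω ⊕ [ p' ] , (ℤ.- p , p' , refl) , (begin
        [ p ] ⊗ θ ⊕ [ q ]
          ≡⟨ cong ([ p ] ⊗ θ ⊕_) q≡p'a+pb ⟩
        [ p ] ⊗ θ ⊕ ([ p' ] ⊗ [ a ] ⊕ [ p ] ⊗ [ b ])
          ≡⟨ solve 5 (λ p θ p' A B → p :* θ :+ (p' :* A :+ p :* B) := :- (:- p) :* θ :+ (A :* p' :- (:- p) :* B))
               refl [ p ] θ [ p' ] [ a ] [ b ] ⟩
        ⊝ (⊝ [ p ]) ⊗ θ ⊕ ([ a ] ⊗ [ p' ] ⊖ ⊝ [ p ] ⊗ [ b ])
          ≡⟨ cong (λ t → ⊝ t ⊗ θ ⊕ ([ a ] ⊗ [ p' ] ⊖ t ⊗ [ b ])) (ιK-neg p) ⟨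
        ⊝ [ ℤ.- p ] ⊗ θ ⊕ ([ a ] ⊗ [ p' ] ⊖ [ ℤ.- p ] ⊗ [ b ])
          ≡⟨ a·conj (ℤ.- p) p' ⟨
        [ a ] ⊗ conj D ([ ℤ.- p ] ⊗ ω ⊕ [ p' ]) ∎)
      where
      q-pb≡p'a : [ q ] ⊖ [ p ] ⊗ [ b ] ≡ [ p' ] ⊗ [ a ]
      q-pb≡p'a = proj₁ (Span-injective ω₂≢0
        (IsInt-⊖ (IsInt-ιK q) (IsInt-⊗ (IsInt-ιK p) (IsInt-ιK b))) (IsInt-⊝ (IsInt-⊗ (IsInt-ιK p) (IsInt-ιK c)))
        (IsInt-⊗ (IsInt-ιK p') (IsInt-ιK a)) (IsInt-ιK q')
        (begin
          ([ q ] ⊖ [ p ] ⊗ [ b ]) ⊗ ω ⊕ ⊝ ([ p ] ⊗ [ c ]) ≡⟨ ⊗ω-coords [ p ] [ q ] ⟨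
          ([ p ] ⊗ θ ⊕ [ q ]) ⊗ ω                       ≡⟨ λ'ω≡ ⟩
          [ p' ] ⊗ θ ⊕ [ q' ]                           ≡⟨ cong (_⊕ [ q' ]) (⊗-assoc [ p' ] [ a ] ω) ⟨
          ([ p' ] ⊗ [ a ]) ⊗ ω ⊕ [ q' ]                 ∎))
      q≡p'a+pb : [ q ] ≡ [ p' ] ⊗ [ a ] ⊕ [ p ] ⊗ [ b ]
      q≡p'a+pb = trans (solve 2 (λ q pb → q := (q :- pb) :+ pb) refl [ q ] ([ p ] ⊗ [ b ])) (cong (_⊕ [ p ] ⊗ [ b ]) q-pb≡p'a)

lemma13p3 : (D : ℤ) → D ℤ.< + 0 → IsDiscr D →
    (N : ℕ) → 0 ℕ.< N →
    (a b c : ℤ) → InQ D N a b c →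
    ((A : SubK D) →
        ((SameClass D N A (Lat D a b) × InM D N A) → ∃[ λ' ] (PSet D N a b λ' × (_≐_ D A (scale D λ' (Lat D a b)))))
      × (∃[ λ' ] (PSet D N a b λ' × (_≐_ D A (scale D λ' (Lat D a b)))) → (SameClass D N A (Lat D a b) × InM D N A)))
    × ((λ' μ : K) → PSet D N a b λ' → PSet D N a b μ →
        ((_≐_ D (scale D λ' (Lat D a b)) (scale D μ (Lat D a b))) → ∃[ ζ ] (IsUnit D ζ × Cong1 D N ζ × μ ≡ _*K_ D ζ λ'))
      × (∃[ ζ ] (IsUnit D ζ × Cong1 D N ζ × μ ≡ _*K_ D ζ λ') → (_≐_ D (scale D λ' (Lat D a b)) (scale D μ (Lat D a b)))))
lemma13p3 D D<0 isDiscr N _ (+ ℕ.suc a₀) b c (gcd≡1 , disc , _ , _) =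
    (λ A → (λ A∈class → let (λ' , (λ'𝔠⊆O , λ'≢0 , λ'≡1) , A≋λ'𝔠) = class⇒scale A∈class
                        in λ' , (colon⇒a𝔠̄ λ'𝔠⊆O , λ'≢0 , λ'≡1) , A≋λ'𝔠)
         , (λ (λ' , (λ'∈a𝔠̄ , λ'≢0 , λ'≡1) , A≋λ'𝔠) → scale⇒class (a𝔠̄⇒colon λ'∈a𝔠̄ , λ'≢0 , λ'≡1) A≋λ'𝔠))
  , (λ λ' μ (_ , λ'≢0 , λ'≡1) (_ , μ≢0 , μ≡1) →
         same-scale⇒unit λ'≢0 μ≢0 λ'≡1 μ≡1 , λ (_ , ζ-unit , _ , μ≡ζλ') → unit⇒same-scale ζ-unit μ≡ζλ')
  where
  open FormLattice D a₀ b c disc gcd≡1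
  open Classes D D<0 isDiscr N 𝔠-isProperModule
lemma13p3 D _ _ N _ (+ 0)     b c (_ , _ , ℤ.+<+ () , _)
lemma13p3 D _ _ N _ -[1+ _ ] b c (_ , _ , () , _)
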